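{- Let $\alpha=-\log(\frac{1}{\sqrt2}+\frac14)$ ($\approx 0.063$). For every triangle-free $n$-vertex graph $G$ with a fixed order $\prec$ on $V(G)$, and every $x\in[0,1]$, $$\log\left|\{I: t(I)\ge xn\}\right|\le\left(\tfrac12-\alpha x+o(1)\right)n,$$ where $I$ ranges over maximal independent sets of $G$ and $o(1)$ denotes a term tending to $0$ as $n\to\infty$.
   Context: $\log=\log_2$; $N(x)$ is the neighborhood of $x$ and $d_S(x)=|N(x)\cap S|$. For a maximal independent set $I$ of $G$ run the following process: set $X_0=V(G)$ and for $i=1,2,\ldots$: (1) let $x_i$ be the $\prec$-first vertex of $X_{i-1}$ among those maximizing $d_{X_{i-1}}(\cdot)$ over $X_{i-1}$; (2) if $x_i\in I$ set $X_i=X_{i-1}\setminus(\{x_i\}\cup N(x_i))$, otherwise set $X_i=X_{i-1}\setminus\{x_i\}$; (3) terminate if $d_{X_i}(x)\le 2$ for all $x\in X_i$. $t(I)$ denotes the number of steps $t$ performed.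
   Formalization: The parameter x takes only rational values in $[0,1]$. -}

module Defs where

open import Data.Bool using (Bool; true; false; _∧_; _∨_; not; if_then_else_)
open import Data.Nat as ℕ using (ℕ; zero; suc; _+_; _*_; _^_; _≤ᵇ_; _<ᵇ_; _≡ᵇ_)
open import Data.Integer as ℤ using (ℤ; +_; _-_)
open import Data.Fin using (Fin; toℕ)
open import Data.Fin.Subset using (Subset; _∈_; _∉_; _⊆_)
open import Data.Fin.Permutation using (Permutation′; _⟨$⟩ʳ_)
open import Data.List using (List; []; _∷_; map; foldr; length)
open import Data.Bool.ListAction using (all)
open import Data.Nat.ListAction using (sum)
open import Data.List.Relation.Unary.All using (All)
open import Data.List.Relation.Unary.Unique.Propositional using (Unique)
open import Data.Vec using (lookup; tabulate)
open import Data.Fin.Properties using () renaming (_≟_ to _≟ᶠ_)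
open import Data.Product using (_×_; Σ)
open import Data.Sum using (_⊎_)
open import Data.Maybe using (Maybe; just; nothing)
open import Data.Empty using (⊥)
open import Relation.Nullary.Decidable using (⌊_⌋)
open import Relation.Binary.PropositionalEquality using (_≡_)

record Graph (n : ℕ) : Set where
  field
    adj    : Fin n → Fin n → Bool
    sym    : ∀ u v → adj u v ≡ adj v u
    irrefl : ∀ v → adj v v ≡ false
open Graph public

TriangleFree : ∀ {n} → Graph n → Set
TriangleFree G = ∀ a b c → adj G a b ≡ true → adj G b c ≡ true → adj G a c ≡ true → ⊥

Independent : ∀ {n} → Graph n → Subset n → Set
Independent G I = ∀ u v → u ∈ I → v ∈ I → adj G u v ≡ false

MaximalIndependent : ∀ {n} → Graph n → Subset n → Set
MaximalIndependent G I = Independent G I × (∀ J → Independent G J → I ⊆ J → J ⊆ I)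

-- The process defining t(I).
-- The fixed linear order ≺ on V(G) = Fin n is given by a permutation ρ:
-- u ≺ v  iff  toℕ (ρ u) < toℕ (ρ v).

module Process {n : ℕ} (G : Graph n) (ρ : Permutation′ n) (I : Subset n) where

  rank : Fin n → ℕ
  rank v = toℕ (ρ ⟨$⟩ʳ v)

  vertices : List (Fin n)
  vertices = Data.List.allFin n
    where import Data.List

  deg : Subset n → Fin n → ℕ
  deg X v = sum (map (λ w → if lookup X w ∧ adj G v w then 1 else 0) vertices)

  -- the ≺-first vertex of X among those maximising d_X (nothing if X = ∅)
  pick : Subset n → Maybe (Fin n)
  pick X = foldr step nothing vertices
    where
    better : Fin n → Fin n → Bool
    better v b = (deg X b <ᵇ deg X v) ∨ ((deg X v ≡ᵇ deg X b) ∧ (rank v <ᵇ rank b))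
    step : Fin n → Maybe (Fin n) → Maybe (Fin n)
    step v acc with lookup X v
    ... | false = acc
    ... | true with acc
    ...   | nothing = just v
    ...   | just b  = if better v b then just v else just b

  next : Subset n → Fin n → Subset n
  next X x = tabulate λ w →
    lookup X w ∧ not ⌊ w ≟ᶠ x ⌋ ∧ (if lookup I x then not (adj G x w) else true)

  done : Subset n → Bool
  done X = all (λ w → not (lookup X w) ∨ (deg X w ≤ᵇ 2)) vertices

  -- number of steps performed starting from X, with fuel
  -- (each step removes a vertex, so fuel n suffices from X₀ = V(G))
  steps : ℕ → Subset n → ℕ
  steps zero X = zero
  steps (suc f) X with pick X
  ... | nothing = zero
  ... | just x with done (next X x)
  ...   | true  = 1
  ...   | false = suc (steps f (next X x))

  t : ℕ
  t = steps n (tabulate λ _ → true)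

t : ∀ {n} → Graph n → Permutation′ n → Subset n → ℕ
t G ρ I = Process.t G ρ I

-- The ring ℤ[√2] = { a + b√2 : a b ∈ ℤ } with its (exact) order;
-- (a +√2· b) denotes a + b√2.

record ℤ√2 : Set where
  constructor _+√2·_
  field
    re : ℤ
    ir : ℤ
open ℤ√2 public

infixl 7 _*√_
_*√_ : ℤ√2 → ℤ√2 → ℤ√2
(a +√2· b) *√ (c +√2· d) = ((a ℤ.* c) ℤ.+ (+ 2 ℤ.* (b ℤ.* d))) +√2· ((a ℤ.* d) ℤ.+ (b ℤ.* c))

infixr 8 _^√_
_^√_ : ℤ√2 → ℕ → ℤ√2
x ^√ zero  = (+ 1) +√2· (+ 0)
x ^√ suc k = x *√ (x ^√ k)

fromℕ√ : ℕ → ℤ√2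
fromℕ√ m = (+ m) +√2· (+ 0)

-- a + b√2 ≥ 0 (exact characterisation, √2 irrational)
Nonneg√ : ℤ√2 → Set
Nonneg√ (a +√2· b) =
    (+ 0 ℤ.≤ a × + 0 ℤ.≤ b)
  ⊎ (+ 0 ℤ.≤ a × b ℤ.< + 0 × + 2 ℤ.* (b ℤ.* b) ℤ.≤ a ℤ.* a)
  ⊎ (a ℤ.< + 0 × + 0 ℤ.≤ b × a ℤ.* a ℤ.≤ + 2 ℤ.* (b ℤ.* b))

infix 4 _≤√_
_≤√_ : ℕ → ℤ√2 → Set
m ≤√ (a +√2· b) = Nonneg√ ((a - + m) +√2· b)

-- The bound  log₂ N ≤ (1/2 − α x + ε) n  with α = −log₂(1/√2 + 1/4),
-- x = p/q, ε = 1/k, written exactly:  since 1/√2 + 1/4 = (1 + 2√2)/4,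
-- it is equivalent (both sides raised to the power 2qk) to
--   N^(2qk) · 4^(2pnk) ≤ 2^(nqk + 2nq) · (1 + 2√2)^(2pnk).

Bound : (N n p q k : ℕ) → Set
Bound N n p q k =
  (N ^ (2 * q * k)) * (4 ^ (2 * p * n * k))
    ≤√ (fromℕ√ (2 ^ (n * q * k + 2 * n * q)) *√ (((+ 1) +√2· (+ 2)) ^√ (2 * p * n * k)))

module Submission where

-- Counting the sets I with t(I) ≥ T by following the process. A step at a
-- vertex x of maximum degree d ≥ 3 in the current set X continues from
-- X − N[x] (≥ 4 vertices fewer) if x ∈ I, and from X − x otherwise. When the
-- steps are used up, the Hujter–Tuza theorem bounds what remains: a
-- triangle-free graph on m vertices has ≤ √2^m maximal independent sets. As
-- √2^(m−4) + √2^(m−1) = √2^m (1/4 + 1/√2) and 1/4 + 1/√2 = β/4 with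
-- β = 1 + 2√2 = 4·2^(−α), there are ≤ 4·√2^n (β/4)^T such sets. The reals
-- involved lie in ℕ[√2]; we work with pairs (a , b) for a + b√2 and the
-- relation L ≼ (a , b) expressing L ≤ a + b√2 by integer squares.

open import Defs hiding (sym)
open import Data.Nat using (ℕ; zero; suc; _+_; _*_; _∸_; _^_; _≤_; _<_; z≤n; s≤s; s≤s⁻¹; >-nonZero;
  _≤?_; _≟_; _≤ᵇ_; _<ᵇ_; _≡ᵇ_; _⊓_)
open import Data.Nat.Properties
open import Data.Nat.Tactic.RingSolver using (solve-∀)
open import Data.Nat.ListAction using (sum)
open import Data.Nat.Induction using (<-rec)
open import Data.Bool using (Bool; true; false; _∧_; _∨_; not; T; if_then_else_)
open import Data.Bool.Properties using (¬-not) renaming (_≟_ to _≟ᵇ_)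
open import Data.Bool.ListAction using (all)
open import Data.Fin using (Fin; zero; suc)
open import Data.Fin.Properties using (any?) renaming (_≟_ to _≟ᶠ_; suc-injective to Fin-suc-injective)
open import Data.Fin.Subset using (Subset; _∈_; _∪_; ⁅_⁆) renaming (⊥ to ∅)
open import Data.Fin.Subset.Properties using (x∈⁅x⁆; x∈⁅y⁆⇒x≡y; p⊆p∪q; x∈p∪q⁻; x∈p∪q⁺)
open import Data.Fin.Permutation using (Permutation′)
open import Data.Vec using (lookup; tabulate)
open import Data.Vec.Properties using (lookup∘tabulate; lookup⇒[]=; []=⇒lookup; tabulate∘lookup; tabulate-cong)
open import Data.List using (List; []; _∷_; length; foldr; map; filter; allFin)
open import Data.List.Properties using (filter-all)
open import Data.List.Membership.Propositional.Properties using (∈-allFin)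
open import Data.List.Relation.Unary.All as All using (All; []; _∷_)
open import Data.List.Relation.Unary.All.Properties using (all-filter) renaming (filter⁺ to All-filter⁺)
open import Data.List.Relation.Unary.AllPairs as AllPairs using (AllPairs; []; _∷_)
open import Data.List.Relation.Unary.AllPairs.Properties using () renaming (filter⁺ to AllPairs-filter⁺)
open import Data.List.Relation.Unary.Unique.Propositional using (Unique)
open import Data.Maybe using (Maybe; just; nothing)
open import Data.Product using (Σ; _×_; _,_; proj₁; proj₂)
open import Data.Sum using (_⊎_; inj₁; inj₂)
open import Data.Empty using (⊥-elim)
open import Data.Unit using (tt)
open import Function using (_∘_; id)
open import Relation.Binary.PropositionalEquality
open import Relation.Nullary using (¬_; yes; no; Dec; _×-dec_)
open import Relation.Nullary.Decidable using (⌊_⌋)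
import Data.Integer as ℤ
import Data.Integer.Properties as ℤ

-- squares; √2-comparisons are decided on squares
sq : ℕ → ℕ
sq x = x * x

sq-mono : ∀ {a b} → a ≤ b → sq a ≤ sq b
sq-mono a≤b = *-mono-≤ a≤b a≤b

sq-cancel : ∀ {a b} → sq a ≤ sq b → a ≤ b
sq-cancel {a} {b} sa≤sb with a ≤? b
... | yes a≤b = a≤b
... | no a≰b  = ⊥-elim (<⇒≱ (*-mono-< (≰⇒> a≰b) (≰⇒> a≰b)) sa≤sb)

-- The semiring ℕ[√2]: a pair (a , b) stands for the real a + b√2.
ℕ√2 : Set
ℕ√2 = ℕ × ℕ

infixl 6 _⊕_
infixl 7 _⊗_
infixr 8 _⊙_
infixl 9 _^⊗_

-- addition and multiplication: (a + b√2)(c + d√2) = (ac + 2bd) + (ad + bc)√2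
_⊕_ : ℕ√2 → ℕ√2 → ℕ√2
(a , b) ⊕ (c , d) = (a + c , b + d)

_⊗_ : ℕ√2 → ℕ√2 → ℕ√2
(a , b) ⊗ (c , d) = (a * c + 2 * (b * d) , a * d + b * c)

_⊙_ : ℕ → ℕ√2 → ℕ√2
c ⊙ (a , b) = (c * a , c * b)

one : ℕ√2
one = (1 , 0)

_^⊗_ : ℕ√2 → ℕ → ℕ√2
x ^⊗ zero  = one
x ^⊗ suc k = x ⊗ x ^⊗ k

-- β = 1 + 2√2 = 4 (1/√2 + 1/4): each step of the process multiplies the
-- count by at most β/4 (see the counting claim below)
β : ℕ√2
β = (1 , 2)

√2·_ : ℕ√2 → ℕ√2
√2· (a , b) = (2 * b , a)

√2^_ : ℕ → ℕ√2
√2^ zero  = one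
√2^ suc m = √2· (√2^ m)

-- L ≼ (a , b) means L ≤ a + b√2, i.e. L ∸ a ≤ b√2, i.e. (L ∸ a)² ≤ 2b².
infix 4 _≼_
record _≼_ (L : ℕ) (x : ℕ√2) : Set where
  constructor ≼-intro
  field ≼-sq : sq (L ∸ proj₁ x) ≤ 2 * sq (proj₂ x)
open _≼_ public

≼-monoˡ : ∀ {L L' x} → L' ≤ L → L ≼ x → L' ≼ x
≼-monoˡ {x = a , b} L'≤L (≼-intro h) = ≼-intro (≤-trans (sq-mono (∸-monoˡ-≤ a L'≤L)) h)

≼-monoʳ : ∀ {L a b a' b'} → a ≤ a' → b ≤ b' → L ≼ (a , b) → L ≼ (a' , b')
≼-monoʳ {L} a≤a' b≤b' (≼-intro h) =
  ≼-intro (≤-trans (sq-mono (∸-monoʳ-≤ L a≤a')) (≤-trans h (*-monoʳ-≤ 2 (sq-mono b≤b'))))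

0≼ : ∀ x → 0 ≼ x
0≼ (a , b) = ≼-intro (subst (λ y → sq y ≤ 2 * sq b) (sym (0∸n≡0 a)) z≤n)

≤⇒≼ : ∀ {L c} → L ≤ c → L ≼ (c , 0)
≤⇒≼ L≤c = ≼-intro (subst (λ y → sq y ≤ 0) (sym (m≤n⇒m∸n≡0 L≤c)) z≤n)

≼⇒≤ : ∀ {L c} → L ≼ (c , 0) → L ≤ c
≼⇒≤ {L} {c} (≼-intro h) = m∸n≡0⇒m≤n (n≤0⇒n≡0 (sq-cancel {L ∸ c} {0} h))

cross-≤ : ∀ e f b d → sq e ≤ 2 * sq b → sq f ≤ 2 * sq d → e * f ≤ 2 * (b * d)
cross-≤ e f b d e≤ f≤ = sq-cancel (begin
  sq (e * f)            ≡⟨ sq-* e f ⟩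
  sq e * sq f           ≤⟨ *-mono-≤ e≤ f≤ ⟩
  2 * sq b * (2 * sq d) ≡⟨ sq-2bd b d ⟩
  sq (2 * (b * d))      ∎)
  where
  open ≤-Reasoning
  sq-* : ∀ e f → (e * f) * (e * f) ≡ (e * e) * (f * f)
  sq-* = solve-∀
  sq-2bd : ∀ b d → 2 * (b * b) * (2 * (d * d)) ≡ (2 * (b * d)) * (2 * (b * d))
  sq-2bd = solve-∀

≼-⊕ : ∀ {L M x y} → L ≼ x → M ≼ y → L + M ≼ x ⊕ y
≼-⊕ {L} {M} {a , b} {c , d} (≼-intro h₁) (≼-intro h₂) =
  ≼-intro (≤-trans (sq-mono split) (begin
    sq (e + f)                          ≡⟨ sq-+ e f ⟩
    sq e + 2 * (e * f) + sq f           ≤⟨ +-mono-≤ (+-mono-≤ h₁ (*-monoʳ-≤ 2 (cross-≤ e f b d h₁ h₂))) h₂ ⟩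
    2 * sq b + 2 * (2 * (b * d)) + 2 * sq d ≡⟨ sq-+' b d ⟩
    2 * sq (b + d)                      ∎))
  where
  open ≤-Reasoning
  e = L ∸ a
  f = M ∸ c
  sq-+ : ∀ e f → (e + f) * (e + f) ≡ e * e + 2 * (e * f) + f * f
  sq-+ = solve-∀
  sq-+' : ∀ b d → 2 * (b * b) + 2 * (2 * (b * d)) + 2 * (d * d) ≡ 2 * ((b + d) * (b + d))
  sq-+' = solve-∀
  swap : ∀ a e c f → a + e + (c + f) ≡ a + c + (e + f)
  swap = solve-∀
  split : L + M ∸ (a + c) ≤ e + f
  split = m≤n+o⇒m∸n≤o (L + M) (a + c)
            (≤-trans (+-mono-≤ (m≤n+m∸n L a) (m≤n+m∸n M c)) (≤-reflexive (swap a e c f)))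

≼-⊙ : ∀ c {L x} → L ≼ x → c * L ≼ c ⊙ x
≼-⊙ c {L} {a , b} (≼-intro h) = ≼-intro (begin
  sq (c * L ∸ c * a)  ≡⟨ cong sq (sym (*-distribˡ-∸ c L a)) ⟩
  sq (c * (L ∸ a))    ≡⟨ sq-* c (L ∸ a) ⟩
  sq c * sq (L ∸ a)   ≤⟨ *-monoʳ-≤ (sq c) h ⟩
  sq c * (2 * sq b)   ≡⟨ sq-c2 c b ⟩
  2 * sq (c * b)      ∎)
  where
  open ≤-Reasoning
  sq-* : ∀ c x → (c * x) * (c * x) ≡ (c * c) * (x * x)
  sq-* = solve-∀
  sq-c2 : ∀ c b → (c * c) * (2 * (b * b)) ≡ 2 * ((c * b) * (c * b))
  sq-c2 = solve-∀

-- products: from L ∸ a ≤ b√2 and M ∸ c ≤ d√2 by expanding (a + e)(c + f)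
≼-⊗ : ∀ {L M x y} → L ≼ x → M ≼ y → L * M ≼ x ⊗ y
≼-⊗ {L} {M} {a , b} {c , d} (≼-intro h₁) (≼-intro h₂) =
  ≼-intro (≤-trans (sq-mono split) (begin
    sq (a * f + c * e)                              ≡⟨ sq-+ a f c e ⟩
    sq a * sq f + 2 * (a * c) * (e * f) + sq c * sq e
      ≤⟨ +-mono-≤ (+-mono-≤ (*-monoʳ-≤ (sq a) h₂) (*-monoʳ-≤ (2 * (a * c)) ef≤)) (*-monoʳ-≤ (sq c) h₁) ⟩
    sq a * (2 * sq d) + 2 * (a * c) * (2 * (b * d)) + sq c * (2 * sq b) ≡⟨ sq-+' a b c d ⟩
    2 * sq (a * d + b * c)                          ∎))
  where
  open ≤-Reasoning
  e = L ∸ a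
  f = M ∸ c
  ef≤ = cross-≤ e f b d h₁ h₂
  sq-+ : ∀ a f c e → (a * f + c * e) * (a * f + c * e) ≡ (a * a) * (f * f) + 2 * (a * c) * (e * f) + (c * c) * (e * e)
  sq-+ = solve-∀
  sq-+' : ∀ a b c d → (a * a) * (2 * (d * d)) + 2 * (a * c) * (2 * (b * d)) + (c * c) * (2 * (b * b)) ≡ 2 * ((a * d + b * c) * (a * d + b * c))
  sq-+' = solve-∀
  expand : ∀ a e c f → (a + e) * (c + f) ≡ a * c + (a * f + c * e) + e * f
  expand = solve-∀
  swap : ∀ x y z → x + y + z ≡ x + z + y
  swap = solve-∀
  split : L * M ∸ (a * c + 2 * (b * d)) ≤ a * f + c * e
  split = m≤n+o⇒m∸n≤o (L * M) (a * c + 2 * (b * d)) (begin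
    L * M                                     ≤⟨ *-mono-≤ (m≤n+m∸n L a) (m≤n+m∸n M c) ⟩
    (a + e) * (c + f)                         ≡⟨ expand a e c f ⟩
    a * c + (a * f + c * e) + e * f           ≤⟨ +-monoʳ-≤ (a * c + (a * f + c * e)) ef≤ ⟩
    a * c + (a * f + c * e) + 2 * (b * d)     ≡⟨ swap (a * c) (a * f + c * e) (2 * (b * d)) ⟩
    a * c + 2 * (b * d) + (a * f + c * e)     ∎)

≼-^ : ∀ {L x} k → L ≼ x → L ^ k ≼ x ^⊗ k
≼-^ zero    _   = ≼-intro z≤n
≼-^ (suc k) L≼x = ≼-⊗ L≼x (≼-^ k L≼x)

≼-grow : ∀ {L c d x} → L ≼ x → L ≼ (suc c , d) ⊗ x
≼-grow {c = c} {x = a , b} =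
  ≼-monoʳ (≤-trans (m≤n*m a (suc c)) (m≤m+n _ _)) (≤-trans (m≤n*m b (suc c)) (m≤m+n _ _))

⊗-comm : ∀ x y → x ⊗ y ≡ y ⊗ x
⊗-comm (a , b) (c , d) = cong₂ _,_ (l₁ a b c d) (l₂ a b c d)
  where
  l₁ : ∀ a b c d → a * c + 2 * (b * d) ≡ c * a + 2 * (d * b)
  l₁ = solve-∀
  l₂ : ∀ a b c d → a * d + b * c ≡ c * b + d * a
  l₂ = solve-∀

⊗-assoc : ∀ x y z → x ⊗ y ⊗ z ≡ x ⊗ (y ⊗ z)
⊗-assoc (a , b) (c , d) (e , f) = cong₂ _,_ (l₁ a b c d e f) (l₂ a b c d e f)
  where
  l₁ : ∀ a b c d e f → (a * c + 2 * (b * d)) * e + 2 * ((a * d + b * c) * f)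
                     ≡ a * (c * e + 2 * (d * f)) + 2 * (b * (c * f + d * e))
  l₁ = solve-∀
  l₂ : ∀ a b c d e f → (a * c + 2 * (b * d)) * f + (a * d + b * c) * e
                     ≡ a * (c * f + d * e) + b * (c * e + 2 * (d * f))
  l₂ = solve-∀

⊗-identityʳ : ∀ x → x ⊗ one ≡ x
⊗-identityʳ (a , b) = cong₂ _,_ (l₁ a b) (l₂ a b)
  where
  l₁ : ∀ a b → a * 1 + 2 * (b * 0) ≡ a
  l₁ = solve-∀
  l₂ : ∀ a b → a * 0 + b * 1 ≡ b
  l₂ = solve-∀

⊗-identityˡ : ∀ x → one ⊗ x ≡ x
⊗-identityˡ x = trans (⊗-comm one x) (⊗-identityʳ x)

⊗-⊙ : ∀ c x y → x ⊗ (c ⊙ y) ≡ c ⊙ (x ⊗ y)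
⊗-⊙ c (a , b) (d , e) = cong₂ _,_ (l₁ c a b d e) (l₂ c a b d e)
  where
  l₁ : ∀ c a b d e → a * (c * d) + 2 * (b * (c * e)) ≡ c * (a * d + 2 * (b * e))
  l₁ = solve-∀
  l₂ : ∀ c a b d e → a * (c * e) + b * (c * d) ≡ c * (a * e + b * d)
  l₂ = solve-∀

⊗-⊗-comm : ∀ x y z → x ⊗ (y ⊗ z) ≡ y ⊗ (x ⊗ z)
⊗-⊗-comm x y z = begin
  x ⊗ (y ⊗ z)  ≡⟨ ⊗-assoc x y z ⟨
  x ⊗ y ⊗ z    ≡⟨ cong (_⊗ z) (⊗-comm x y) ⟩
  y ⊗ x ⊗ z    ≡⟨ ⊗-assoc y x z ⟩
  y ⊗ (x ⊗ z)  ∎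
  where open ≡-Reasoning

⊕-2√2 : ∀ x → x ⊕ (0 , 2) ⊗ x ≡ β ⊗ x
⊕-2√2 (a , b) = cong₂ _,_ (l₁ a b) (l₂ a b)
  where
  l₁ : ∀ a b → a + (0 * a + 2 * (2 * b)) ≡ 1 * a + 2 * (2 * b)
  l₁ = solve-∀
  l₂ : ∀ a b → b + (0 * b + 2 * a) ≡ 1 * b + 2 * a
  l₂ = solve-∀

√2^-+3 : ∀ m → √2^ (3 + m) ≡ (0 , 2) ⊗ √2^ m
√2^-+3 m = cong₂ _,_ (l₁ (proj₁ (√2^ m)) (proj₂ (√2^ m))) (l₂ (proj₁ (√2^ m)) (proj₂ (√2^ m)))
  where
  l₁ : ∀ a b → 2 * (2 * b) ≡ 0 * a + 2 * (2 * b)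
  l₁ = solve-∀
  l₂ : ∀ a b → 2 * a ≡ 0 * b + 2 * a
  l₂ = solve-∀

√2^-+4 : ∀ m → √2^ (4 + m) ≡ 4 ⊙ √2^ m
√2^-+4 m = cong₂ _,_ (sym (*-assoc 2 2 (proj₁ (√2^ m)))) (sym (*-assoc 2 2 (proj₂ (√2^ m))))

√2<17/12 : ∀ e x → sq e ≤ 2 * sq x → 12 * e ≤ 17 * x
√2<17/12 e x e≤x√2 = sq-cancel (begin
  sq (12 * e)       ≡⟨ l₁ e ⟩
  144 * sq e        ≤⟨ *-monoʳ-≤ 144 e≤x√2 ⟩
  144 * (2 * sq x)  ≤⟨ ≤-trans (≤-reflexive (l₂ x)) (*-monoˡ-≤ (sq x) (m≤m+n 288 1)) ⟩
  289 * sq x        ≡⟨ l₃ x ⟩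
  sq (17 * x)       ∎)
  where
  open ≤-Reasoning
  l₁ : ∀ e → (12 * e) * (12 * e) ≡ 144 * (e * e)
  l₁ = solve-∀
  l₂ : ∀ x → 144 * (2 * (x * x)) ≡ 288 * (x * x)
  l₂ = solve-∀
  l₃ : ∀ x → 289 * (x * x) ≡ (17 * x) * (17 * x)
  l₃ = solve-∀

-- β ≤ 4: from L ≤ (a + b√2)(1 + 2√2) follows L ≤ 4 (a + b√2), using √2 < 17/12
≼-β≤4 : ∀ {L} x → L ≼ β ⊗ x → L ≼ 4 ⊙ x
≼-β≤4 {L} (a , b) (≼-intro h) = ≼-intro (*-cancelˡ-≤ 144 (begin
  144 * sq g             ≡⟨ l₁ g ⟩
  sq (12 * g)            ≤⟨ sq-mono 12g≤65b ⟩
  sq (65 * b)            ≤⟨ ≤-trans (≤-reflexive (l₂ b)) (*-monoˡ-≤ (sq b) (m≤m+n 4225 383)) ⟩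
  4608 * sq b            ≡⟨ l₃ b ⟩
  144 * (2 * sq (4 * b)) ∎))
  where
  open ≤-Reasoning
  e = L ∸ (1 * a + 2 * (2 * b))
  g = L ∸ 4 * a
  l₁ : ∀ g → 144 * (g * g) ≡ (12 * g) * (12 * g)
  l₁ = solve-∀
  l₂ : ∀ b → (65 * b) * (65 * b) ≡ 4225 * (b * b)
  l₂ = solve-∀
  l₃ : ∀ b → 4608 * (b * b) ≡ 144 * (2 * ((4 * b) * (4 * b)))
  l₃ = solve-∀
  expand : ∀ a b e → 12 * ((1 * a + 2 * (2 * b)) + e) ≡ 12 * a + 48 * b + 12 * e
  expand = solve-∀
  collect : ∀ a b → 12 * a + 48 * b + 17 * (1 * b + 2 * a) ≡ 46 * a + 65 * b
  collect = solve-∀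
  12L≤ : 12 * L ≤ 12 * (4 * a) + 65 * b
  12L≤ = begin
    12 * L                                     ≤⟨ *-monoʳ-≤ 12 (m≤n+m∸n L (1 * a + 2 * (2 * b))) ⟩
    12 * ((1 * a + 2 * (2 * b)) + e)           ≡⟨ expand a b e ⟩
    12 * a + 48 * b + 12 * e                   ≤⟨ +-monoʳ-≤ (12 * a + 48 * b) (√2<17/12 e (1 * b + 2 * a) h) ⟩
    12 * a + 48 * b + 17 * (1 * b + 2 * a)     ≡⟨ collect a b ⟩
    46 * a + 65 * b                            ≤⟨ +-monoˡ-≤ (65 * b) (*-monoˡ-≤ a (m≤m+n 46 2)) ⟩
    48 * a + 65 * b                            ≡⟨ cong (_+ 65 * b) (*-assoc 12 4 a) ⟩
    12 * (4 * a) + 65 * b                      ∎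
  12g≤65b : 12 * g ≤ 65 * b
  12g≤65b = begin
    12 * g                  ≡⟨ *-distribˡ-∸ 12 L (4 * a) ⟩
    12 * L ∸ 12 * (4 * a)   ≤⟨ m≤n+o⇒m∸n≤o (12 * L) (12 * (4 * a)) 12L≤ ⟩
    65 * b                  ∎

≼-cancel4 : ∀ {M} x → 4 * M ≼ 4 ⊙ x → M ≼ x
≼-cancel4 {M} (a , b) (≼-intro h) = ≼-intro (*-cancelˡ-≤ 16 (begin
  16 * sq (M ∸ a)      ≡⟨ l₁ (M ∸ a) ⟩
  sq (4 * (M ∸ a))     ≡⟨ cong sq (*-distribˡ-∸ 4 M a) ⟩
  sq (4 * M ∸ 4 * a)   ≤⟨ h ⟩
  2 * sq (4 * b)       ≡⟨ l₂ b ⟩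
  16 * (2 * sq b)      ∎))
  where
  open ≤-Reasoning
  l₁ : ∀ x → 16 * (x * x) ≡ (4 * x) * (4 * x)
  l₁ = solve-∀
  l₂ : ∀ b → 2 * ((4 * b) * (4 * b)) ≡ 16 * (2 * (b * b))
  l₂ = solve-∀

-- M 4^E ≤ x β^E implies M ≤ x, as β ≤ 4
≼-cancel-β : ∀ {M} E x → M * 4 ^ E ≼ x ⊗ β ^⊗ E → M ≼ x
≼-cancel-β {M} zero x h =
  subst₂ _≼_ (*-identityʳ M) (⊗-identityʳ x) h
≼-cancel-β {M} (suc E) x h =
  ≼-cancel4 x (≼-β≤4 x (subst (4 * M ≼_) (⊗-comm x β) (≼-cancel-β E (x ⊗ β) h')))
  where
  reassoc : ∀ m y → m * (4 * y) ≡ 4 * m * y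
  reassoc = solve-∀
  h' : 4 * M * 4 ^ E ≼ x ⊗ β ⊗ β ^⊗ E
  h' = subst₂ _≼_ (reassoc M (4 ^ E)) (sym (⊗-assoc x β (β ^⊗ E))) h

√2^-shape : ∀ m → Σ ℕ λ c → 1 ≤ c × (√2^ m ≡ (c , 0) ⊎ √2^ m ≡ (0 , c))
√2^-shape zero = 1 , ≤-refl , inj₁ refl
√2^-shape (suc m) with √2^-shape m
... | c , 1≤c , inj₁ eq = c , 1≤c , inj₂ (cong √2·_ eq)
... | c , 1≤c , inj₂ eq = 2 * c , ≤-trans 1≤c (m≤m+n c _) , inj₁ (cong √2·_ eq)

1≼√2^ : ∀ m → 1 ≼ √2^ m
1≼√2^ m with √2^-shape m
... | c , 1≤c , inj₁ eq = subst (1 ≼_) (sym eq) (≤⇒≼ 1≤c)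
... | c , 1≤c , inj₂ eq = subst (1 ≼_) (sym eq) (≼-intro (≤-trans (*-mono-≤ 1≤c 1≤c) (m≤m+n (c * c) _)))

≼-√2^-suc : ∀ {L} m → L ≼ √2^ m → L ≼ √2^ (suc m)
≼-√2^-suc {L} m L≼ with √2^-shape m
... | c , _ , inj₁ eq rewrite eq = ≼-intro (≤-trans (sq-mono (≼⇒≤ L≼)) (m≤m+n (c * c) _))
... | c , _ , inj₂ eq rewrite eq = ≤⇒≼ (sq-cancel (begin
  L * L             ≤⟨ ≼-sq L≼ ⟩
  2 * (c * c)       ≤⟨ *-monoˡ-≤ (c * c) (m≤m+n 2 2) ⟩
  4 * (c * c)       ≡⟨ l c ⟩
  (2 * c) * (2 * c) ∎))
  where
  open ≤-Reasoning
  l : ∀ c → 4 * (c * c) ≡ (2 * c) * (2 * c)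
  l = solve-∀

≼-√2^-double : ∀ {A B} m → A ≼ √2^ m → B ≼ √2^ m → A + B ≼ √2^ (2 + m)
≼-√2^-double {A} {B} m hA hB = subst (A + B ≼_) (cong₂ _,_ (double (proj₁ (√2^ m))) (double (proj₂ (√2^ m)))) (≼-⊕ hA hB)
  where
  double : ∀ a → a + a ≡ 2 * a
  double = solve-∀

-- the recursion of the counting argument: from A ≤ z√2^m and
-- B ≤ z√2^(3+m) = 2√2·z√2^m follows A + B ≤ (1 + 2√2) z√2^m
≼-branch : ∀ {A B} z m → A ≼ z ⊗ √2^ m → B ≼ z ⊗ √2^ (3 + m) → A + B ≼ β ⊗ (z ⊗ √2^ m)
≼-branch {A} {B} z m hA hB = subst (A + B ≼_) split (≼-⊕ hA hB)
  where
  w = z ⊗ √2^ m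
  split : w ⊕ z ⊗ √2^ (3 + m) ≡ β ⊗ w
  split = trans (cong (w ⊕_) (trans (cong (z ⊗_) (√2^-+3 m)) (⊗-⊗-comm z (0 , 2) (√2^ m))))
                (⊕-2√2 w)

-- with z = 1 and β ≤ 4: A ≤ √2^m and B ≤ √2^(3+m) give A + B ≤ √2^(4+m)
≼-√2^-branch : ∀ {A B} m → A ≼ √2^ m → B ≼ √2^ (3 + m) → A + B ≼ √2^ (4 + m)
≼-√2^-branch {A} {B} m hA hB =
  subst (A + B ≼_) (sym (√2^-+4 m)) (≼-β≤4 (√2^ m) (subst (λ y → A + B ≼ β ⊗ y) (⊗-identityˡ (√2^ m))
    (≼-branch one m (subst (A ≼_) (sym (⊗-identityˡ (√2^ m))) hA)
                     (subst (B ≼_) (sym (⊗-identityˡ (√2^ (3 + m)))) hB))))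

⊙-as-⊗ : ∀ c x → c ⊙ x ≡ (c , 0) ⊗ x
⊙-as-⊗ c (a , b) = cong₂ _,_ (l₁ c a b) (l₂ c a b)
  where
  l₁ : ∀ c a b → c * a ≡ c * a + 2 * (0 * b)
  l₁ = solve-∀
  l₂ : ∀ c a b → c * b ≡ c * b + 0 * a
  l₂ = solve-∀

c0⊗c0 : ∀ c d → (c , 0) ⊗ (d , 0) ≡ (c * d , 0)
c0⊗c0 c d = cong₂ _,_ (l₁ c d) (l₂ c d)
  where
  l₁ : ∀ c d → c * d + 2 * (0 * 0) ≡ c * d
  l₁ = solve-∀
  l₂ : ∀ c d → c * 0 + 0 * d ≡ 0
  l₂ = solve-∀

^⊗-distrib-⊗ : ∀ x y k → (x ⊗ y) ^⊗ k ≡ x ^⊗ k ⊗ y ^⊗ k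
^⊗-distrib-⊗ x y zero    = refl
^⊗-distrib-⊗ x y (suc k) = begin
  x ⊗ y ⊗ (x ⊗ y) ^⊗ k           ≡⟨ cong (x ⊗ y ⊗_) (^⊗-distrib-⊗ x y k) ⟩
  x ⊗ y ⊗ (x ^⊗ k ⊗ y ^⊗ k)       ≡⟨ ⊗-assoc x y _ ⟩
  x ⊗ (y ⊗ (x ^⊗ k ⊗ y ^⊗ k))     ≡⟨ cong (x ⊗_) (⊗-⊗-comm y (x ^⊗ k) (y ^⊗ k)) ⟩
  x ⊗ (x ^⊗ k ⊗ (y ⊗ y ^⊗ k))     ≡⟨ ⊗-assoc x (x ^⊗ k) _ ⟨
  x ⊗ x ^⊗ k ⊗ (y ⊗ y ^⊗ k)       ∎
  where open ≡-Reasoning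

^⊗-+ : ∀ x a b → x ^⊗ (a + b) ≡ x ^⊗ a ⊗ x ^⊗ b
^⊗-+ x zero    b = sym (⊗-identityˡ (x ^⊗ b))
^⊗-+ x (suc a) b = trans (cong (x ⊗_) (^⊗-+ x a b)) (sym (⊗-assoc x (x ^⊗ a) (x ^⊗ b)))

^⊗-* : ∀ x a b → x ^⊗ (a * b) ≡ (x ^⊗ a) ^⊗ b
^⊗-* x a zero    = cong (x ^⊗_) (*-zeroʳ a)
^⊗-* x a (suc b) = begin
  x ^⊗ (a * suc b)           ≡⟨ cong (x ^⊗_) (*-suc a b) ⟩
  x ^⊗ (a + a * b)           ≡⟨ ^⊗-+ x a (a * b) ⟩
  x ^⊗ a ⊗ x ^⊗ (a * b)      ≡⟨ cong (x ^⊗ a ⊗_) (^⊗-* x a b) ⟩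
  x ^⊗ a ⊗ (x ^⊗ a) ^⊗ b     ∎
  where open ≡-Reasoning

c0-^⊗ : ∀ c k → (c , 0) ^⊗ k ≡ (c ^ k , 0)
c0-^⊗ c zero    = refl
c0-^⊗ c (suc k) = trans (cong ((c , 0) ⊗_) (c0-^⊗ c k)) (c0⊗c0 c (c ^ k))

√2^-sq : ∀ m → √2^ m ⊗ √2^ m ≡ (2 ^ m , 0)
√2^-sq zero    = refl
√2^-sq (suc m) = trans (√2·⊗√2· (√2^ m) (√2^ m)) (cong (2 ⊙_) (√2^-sq m))
  where
  √2·⊗√2· : ∀ x y → √2· x ⊗ √2· y ≡ 2 ⊙ (x ⊗ y)
  √2·⊗√2· (a , b) (c , d) = cong₂ _,_ (l₁ a b c d) (l₂ a b c d)
    where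
    l₁ : ∀ a b c d → 2 * b * (2 * d) + 2 * (a * c) ≡ 2 * (a * c + 2 * (b * d))
    l₁ = solve-∀
    l₂ : ∀ a b c d → 2 * b * c + a * (2 * d) ≡ 2 * (a * d + b * c)
    l₂ = solve-∀

√2^-even-power : ∀ m j → √2^ m ^⊗ (2 * j) ≡ (2 ^ (m * j) , 0)
√2^-even-power m j = begin
  √2^ m ^⊗ (2 * j)                 ≡⟨ cong (√2^ m ^⊗_) (*-comm 2 j) ⟩
  √2^ m ^⊗ (j * 2)                 ≡⟨ ^⊗-* (√2^ m) j 2 ⟩
  √2^ m ^⊗ j ⊗ (√2^ m ^⊗ j ⊗ one)  ≡⟨ cong (√2^ m ^⊗ j ⊗_) (⊗-identityʳ _) ⟩
  √2^ m ^⊗ j ⊗ √2^ m ^⊗ j          ≡⟨ ^⊗-distrib-⊗ (√2^ m) (√2^ m) j ⟨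
  (√2^ m ⊗ √2^ m) ^⊗ j             ≡⟨ cong (_^⊗ j) (√2^-sq m) ⟩
  (2 ^ m , 0) ^⊗ j                 ≡⟨ c0-^⊗ (2 ^ m) j ⟩
  ((2 ^ m) ^ j , 0)                ≡⟨ cong (_, 0) (^-*-assoc 2 m j) ⟩
  (2 ^ (m * j) , 0)                ∎
  where open ≡-Reasoning

ι : ℕ√2 → ℤ√2
ι (a , b) = (ℤ.+ a) +√2· (ℤ.+ b)

ι-⊗ : ∀ x y → ι (x ⊗ y) ≡ ι x *√ ι y
ι-⊗ (a , b) (c , d) = cong₂ _+√2·_ re-eq ir-eq
  where
  re-eq : ℤ.+ (a * c + 2 * (b * d)) ≡ (ℤ.+ a ℤ.* ℤ.+ c) ℤ.+ (ℤ.+ 2 ℤ.* (ℤ.+ b ℤ.* ℤ.+ d))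
  re-eq = trans (ℤ.pos-+ (a * c) (2 * (b * d)))
            (cong₂ ℤ._+_ (ℤ.pos-* a c) (trans (ℤ.pos-* 2 (b * d)) (cong (ℤ.+ 2 ℤ.*_) (ℤ.pos-* b d))))
  ir-eq : ℤ.+ (a * d + b * c) ≡ (ℤ.+ a ℤ.* ℤ.+ d) ℤ.+ (ℤ.+ b ℤ.* ℤ.+ c)
  ir-eq = trans (ℤ.pos-+ (a * d) (b * c)) (cong₂ ℤ._+_ (ℤ.pos-* a d) (ℤ.pos-* b c))

ι-^ : ∀ x k → ι (x ^⊗ k) ≡ ι x ^√ k
ι-^ x zero    = refl
ι-^ x (suc k) = trans (ι-⊗ x (x ^⊗ k)) (cong (ι x *√_) (ι-^ x k))

≼⇒≤√ : ∀ {L x} → L ≼ x → L ≤√ ι x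
≼⇒≤√ {L} {A , B} (≼-intro h) with L ≤? A
... | yes L≤A = inj₁ (subst (ℤ.+ 0 ℤ.≤_) (sym A-L≡) (ℤ.+≤+ z≤n) , ℤ.+≤+ z≤n)
  where
  A-L≡ : ℤ.+ A ℤ.- ℤ.+ L ≡ ℤ.+ (A ∸ L)
  A-L≡ = trans (ℤ.m-n≡m⊖n A L) (ℤ.⊖-≥ L≤A)
... | no L≰A = inj₂ (inj₂ (negative , ℤ.+≤+ z≤n , squares))
  where
  A<L = ≰⇒> L≰A
  d = L ∸ A
  A-L≡ : ℤ.+ A ℤ.- ℤ.+ L ≡ ℤ.- (ℤ.+ d)
  A-L≡ = trans (ℤ.m-n≡m⊖n A L) (ℤ.⊖-< A<L)
  -d<0 : ∀ d → 1 ≤ d → ℤ.- (ℤ.+ d) ℤ.< ℤ.+ 0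
  -d<0 (suc d) _ = ℤ.-<+
  negative : (ℤ.+ A ℤ.- ℤ.+ L) ℤ.< ℤ.+ 0
  negative = subst (ℤ._< ℤ.+ 0) (sym A-L≡) (-d<0 d (m<n⇒0<n∸m A<L))
  neg-sq : ∀ x → (ℤ.- x) ℤ.* (ℤ.- x) ≡ x ℤ.* x
  neg-sq x = trans (sym (ℤ.neg-distribˡ-* x (ℤ.- x)))
               (trans (cong ℤ.-_ (sym (ℤ.neg-distribʳ-* x x))) (ℤ.neg-involutive (x ℤ.* x)))
  squares : (ℤ.+ A ℤ.- ℤ.+ L) ℤ.* (ℤ.+ A ℤ.- ℤ.+ L) ℤ.≤ ℤ.+ 2 ℤ.* (ℤ.+ B ℤ.* ℤ.+ B)
  squares = subst₂ ℤ._≤_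
    (sym (trans (cong (λ z → z ℤ.* z) A-L≡) (trans (neg-sq (ℤ.+ d)) (sym (ℤ.pos-* d d)))))
    (trans (ℤ.pos-* 2 (B * B)) (cong (ℤ.+ 2 ℤ.*_) (ℤ.pos-* B B)))
    (ℤ.+≤+ h)

shifted : ∀ k {m} → k ≤ m → Σ ℕ λ m₀ → m ≡ k + m₀
shifted k {m} k≤m = m ∸ k , sym (m+[n∸m]≡n k≤m)

drop-≤ : ∀ {a k s m} → a + k ≤ s → s ≤ m → k ≤ m
drop-≤ {a} shrink s≤m = m+n≤o⇒n≤o a (≤-trans shrink s≤m)

shrink-≤ : ∀ {a k s m} → a + k ≤ s → s ≤ k + m → a ≤ m
shrink-≤ {a} {k} {s} {m} shrink s≤k+m = +-cancelʳ-≤ k a m (≤-trans shrink (≤-trans s≤k+m (≤-reflexive (+-comm k m))))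

-- the indicator, in the form used by Process.deg
ind : Bool → ℕ
ind b = if b then 1 else 0

ind≤1 : ∀ b → ind b ≤ 1
ind≤1 true  = ≤-refl
ind≤1 false = z≤n

ΣF : ∀ {k} → (Fin k → ℕ) → ℕ
ΣF {zero}  f = 0
ΣF {suc k} f = f zero + ΣF (f ∘ suc)

ΣF-mono : ∀ {k} {f g : Fin k → ℕ} → (∀ w → f w ≤ g w) → ΣF f ≤ ΣF g
ΣF-mono {zero}  f≤g = z≤n
ΣF-mono {suc k} f≤g = +-mono-≤ (f≤g zero) (ΣF-mono (f≤g ∘ suc))

ΣF-cong : ∀ {k} {f g : Fin k → ℕ} → (∀ w → f w ≡ g w) → ΣF f ≡ ΣF g
ΣF-cong {zero}  f≡g = refl
ΣF-cong {suc k} f≡g = cong₂ _+_ (f≡g zero) (ΣF-cong (f≡g ∘ suc))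

ΣF-+ : ∀ {k} (f g : Fin k → ℕ) → ΣF (λ w → f w + g w) ≡ ΣF f + ΣF g
ΣF-+ {zero}  f g = refl
ΣF-+ {suc k} f g = trans (cong (f zero + g zero +_) (ΣF-+ (f ∘ suc) (g ∘ suc)))
                         (+-+-comm (f zero) (g zero) (ΣF (f ∘ suc)) (ΣF (g ∘ suc)))
  where
  +-+-comm : ∀ a b c d → a + b + (c + d) ≡ a + c + (b + d)
  +-+-comm = solve-∀

ΣF-point : ∀ {k} (f : Fin k → ℕ) x → f x ≤ ΣF f
ΣF-point f zero = m≤m+n _ _
ΣF-point {suc k} f (suc x) = ≤-trans (ΣF-point (f ∘ suc) x) (m≤n+m _ _)

ΣF-zero : ∀ {k} (f : Fin k → ℕ) → (∀ w → f w ≡ 0) → ΣF f ≡ 0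
ΣF-zero {k} f f≡0 = trans (ΣF-cong f≡0) (zeros k)
  where
  zeros : ∀ k → ΣF {k} (λ _ → 0) ≡ 0
  zeros zero    = refl
  zeros (suc k) = zeros k

ΣF-≤-card : ∀ {k} (f : Fin k → ℕ) → (∀ w → f w ≤ 1) → ΣF f ≤ k
ΣF-≤-card {zero}  f f≤1 = z≤n
ΣF-≤-card {suc k} f f≤1 = +-mono-≤ (f≤1 zero) (ΣF-≤-card (f ∘ suc) (f≤1 ∘ suc))

δ : ∀ {k} → Fin k → Fin k → ℕ
δ x w = ind ⌊ w ≟ᶠ x ⌋

ΣF-δ : ∀ {k} (x : Fin k) → ΣF (δ x) ≡ 1
ΣF-δ {suc k} zero    = cong suc (ΣF-zero {k} (λ w → δ zero (suc w)) δ-zero-suc)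
  where
  δ-zero-suc : ∀ {k} (w : Fin k) → δ zero (suc w) ≡ 0
  δ-zero-suc w with suc w ≟ᶠ zero
  ... | no _ = refl
ΣF-δ {suc k} (suc x) = cong₂ _+_ δ-suc-zero (trans (ΣF-cong δ-suc-suc) (ΣF-δ x))
  where
  δ-suc-zero : δ (suc x) zero ≡ 0
  δ-suc-zero with zero ≟ᶠ suc x
  ... | no _ = refl
  δ-suc-suc : ∀ w → δ (suc x) (suc w) ≡ δ x w
  δ-suc-suc w with suc w ≟ᶠ suc x | w ≟ᶠ x
  ... | yes _  | yes _  = refl
  ... | no _   | no _   = refl
  ... | yes eq | no neq = ⊥-elim (neq (Fin-suc-injective eq))
  ... | no neq | yes eq = ⊥-elim (neq (cong suc eq))

ΣF-distinct : ∀ {k} (ws : List (Fin k)) (f : Fin k → ℕ) →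
              AllPairs _≢_ ws → All (λ w → 1 ≤ f w) ws → length ws ≤ ΣF f
ΣF-distinct []       f _              _            = z≤n
ΣF-distinct (x ∷ xs) f (x∉xs ∷ xs-distinct) (1≤fx ∷ 1≤fxs) = begin
  suc (length xs)             ≤⟨ s≤s (ΣF-distinct xs f' xs-distinct (All.zipWith f'-pos (x∉xs , 1≤fxs))) ⟩
  1 + ΣF f'                   ≡⟨ cong (_+ ΣF f') (ΣF-δ x) ⟨
  ΣF (δ x) + ΣF f'            ≡⟨ ΣF-+ (δ x) f' ⟨
  ΣF (λ w → δ x w + f' w)     ≤⟨ ΣF-mono split ⟩
  ΣF f                        ∎
  where
  open ≤-Reasoning
  f' : Fin _ → ℕ
  f' w = f w ∸ δ x w
  split : ∀ w → δ x w + f' w ≤ f w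
  split w with w ≟ᶠ x
  ... | yes refl = ≤-reflexive (m+[n∸m]≡n 1≤fx)
  ... | no _     = ≤-refl
  f'-pos : ∀ {y} → x ≢ y × 1 ≤ f y → 1 ≤ f' y
  f'-pos {y} (x≢y , 1≤fy) with y ≟ᶠ x
  ... | yes y≡x = ⊥-elim (x≢y (sym y≡x))
  ... | no _    = 1≤fy

find : ∀ {k} {P : Fin k → Set} → (∀ w → Dec (P w)) → Σ (Fin k) P ⊎ (∀ w → ¬ P w)
find P? with any? P?
... | yes found = inj₁ found
... | no  none  = inj₂ (λ w pw → none (w , pw))

search : ∀ {k} (f : Fin k → Bool) → (Σ (Fin k) λ w → f w ≡ true) ⊎ (∀ w → f w ≡ false)
search f with find (λ w → f w ≟ᵇ true)
... | inj₁ found = inj₁ found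
... | inj₂ none  = inj₂ (λ w → ¬-not (none w))

select : ∀ {n} → Fin n → Bool → List (Subset n) → List (Subset n)
select v b = filter (λ J → lookup J v ≟ᵇ b)

select-split : ∀ {n} (v : Fin n) L → length L ≤ length (select v true L) + length (select v false L)
select-split v []      = z≤n
select-split v (J ∷ L) with lookup J v
... | true  = s≤s (select-split v L)
... | false = ≤-trans (s≤s (select-split v L)) (≤-reflexive (sym (+-suc _ _)))

select-all : ∀ {n} (v : Fin n) b L → All (λ J → lookup J v ≡ b) (select v b L)
select-all v b = all-filter (λ J → lookup J v ≟ᵇ b)

select-forced : ∀ {n} (v : Fin n) b {L} → All (λ J → lookup J v ≡ b) L → select v b L ≡ L
select-forced v b = filter-all (λ J → lookup J v ≟ᵇ b)

allPairs-with : ∀ {A : Set} {Q : A → Set} {R R' : A → A → Set} {L} → All Q L → AllPairs R L →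
                (∀ {x y} → Q x → Q y → R x y → R' x y) → AllPairs R' L
allPairs-with []        []        f = []
allPairs-with (qx ∷ qs) (rx ∷ rs) f = All.zipWith (λ (qy , r) → f qx qy r) (qs , rx) ∷ allPairs-with qs rs f

minimum : ∀ {A : Set} → ℕ → (A → ℕ) → List A → ℕ
minimum d g = foldr (λ x r → g x ⊓ r) d

minimum-≤ : ∀ {A : Set} d (g : A → ℕ) L → All (λ x → minimum d g L ≤ g x) L
minimum-≤ d g []      = []
minimum-≤ d g (x ∷ L) = m⊓n≤m (g x) _ ∷ All.map (≤-trans (m⊓n≤n (g x) _)) (minimum-≤ d g L)

minimum-attained : ∀ {A : Set} (P : ℕ → Set) {d} {g : A → ℕ} {L} → P d → All (P ∘ g) L → P (minimum d g L)
minimum-attained P Pd []                         = Pd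
minimum-attained P {d} {g} {x ∷ L} Pd (Pgx ∷ PgL) with ⊓-sel (g x) (minimum d g L)
... | inj₁ eq = subst P (sym eq) Pgx
... | inj₂ eq = subst P (sym eq) (minimum-attained P Pd PgL)

all-absurd : ∀ {A : Set} {P : A → Set} {L} → (∀ {x} → ¬ P x) → All P L → length L ≡ 0
all-absurd ¬P []      = refl
all-absurd ¬P (p ∷ _) = ⊥-elim (¬P p)

∧-true : ∀ {a b} → a ∧ b ≡ true → a ≡ true × b ≡ true
∧-true {true} {true} _ = refl , refl

true≢false : true ≢ false
true≢false ()

module VertexSets {n : ℕ} (G : Graph n) where

  -- membership, read off the Boolean vector as the process does
  infix 4 _∈ᵇ_
  _∈ᵇ_ : Fin n → Subset n → Set
  w ∈ᵇ X = lookup X w ≡ true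

  size : Subset n → ℕ
  size X = ΣF (λ w → ind (lookup X w))

  deg : Subset n → Fin n → ℕ
  deg X v = ΣF (λ w → ind (lookup X w ∧ adj G v w))

  size≤n : ∀ X → size X ≤ n
  size≤n X = ΣF-≤-card _ (λ w → ind≤1 (lookup X w))

  adj-sym : ∀ u v → adj G u v ≡ true → adj G v u ≡ true
  adj-sym u v uv = trans (Graph.sym G v u) uv

  -- X minus v, and minus N(v) too when b = true; this is Process.next with b = (v ∈ I)
  remove : Subset n → Fin n → Bool → Subset n
  remove X v b = tabulate λ w → lookup X w ∧ not ⌊ w ≟ᶠ v ⌋ ∧ (if b then not (adj G v w) else true)

  remove-lookup : ∀ X v b w →
    lookup (remove X v b) w ≡ (lookup X w ∧ not ⌊ w ≟ᶠ v ⌋ ∧ (if b then not (adj G v w) else true))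
  remove-lookup X v b w = lookup∘tabulate _ w

  remove-∈ : ∀ X v b w → w ∈ᵇ remove X v b → w ∈ᵇ X × w ≢ v × (b ≡ true → adj G v w ≡ false)
  remove-∈ X v b w w∈ with ∧-true (trans (sym (remove-lookup X v b w)) w∈)
  ... | w∈X , rest with ∧-true rest
  ...   | w≠v , nonadj = w∈X , distinct w≠v , adjacency b nonadj
    where
    distinct : not ⌊ w ≟ᶠ v ⌋ ≡ true → w ≢ v
    distinct ne w≡v with w ≟ᶠ v
    ... | yes _   = true≢false (sym ne)
    ... | no  w≢v = w≢v w≡v
    adjacency : ∀ b → (if b then not (adj G v w) else true) ≡ true → b ≡ true → adj G v w ≡ false
    adjacency true na refl with adj G v w
    ... | false = refl

  remove-⊆ : ∀ X v b w → w ∈ᵇ remove X v b → w ∈ᵇ X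
  remove-⊆ X v b w w∈ = proj₁ (remove-∈ X v b w w∈)

  remove-nonadj : ∀ X v w → w ∈ᵇ remove X v true → adj G v w ≡ false
  remove-nonadj X v w w∈ = proj₂ (proj₂ (remove-∈ X v true w w∈)) refl

  remove-keep : ∀ X v b w → w ∈ᵇ X → w ≢ v → (b ≡ true → adj G v w ≡ false) → w ∈ᵇ remove X v b
  remove-keep X v b w w∈X w≢v nonadj rewrite remove-lookup X v b w | w∈X with w ≟ᶠ v
  ... | yes w≡v = ⊥-elim (w≢v w≡v)
  ... | no _ with b
  ...   | false = refl
  ...   | true rewrite nonadj refl = refl

  remove-gone : ∀ X v b w → lookup (remove X v b) w ≡ false →
                lookup X w ≡ false ⊎ w ≡ v ⊎ (b ≡ true × adj G v w ≡ true)
  remove-gone X v b w gone with lookup X w in w∈X | w ≟ᶠ v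
  ... | false | _        = inj₁ refl
  ... | true  | yes w≡v  = inj₂ (inj₁ w≡v)
  ... | true  | no w≢v with b | adj G v w in a
  ...   | true  | true  = inj₂ (inj₂ (refl , refl))
  ...   | true  | false = ⊥-elim (true≢false (trans (sym (remove-keep X v true w w∈X w≢v (λ _ → a))) gone))
  ...   | false | _     = ⊥-elim (true≢false (trans (sym (remove-keep X v false w w∈X w≢v (λ ()))) gone))

  size-remove-in : ∀ X v → v ∈ᵇ X → ∀ d → d ≤ deg X v → size (remove X v true) + (1 + d) ≤ size X
  size-remove-in X v v∈X d d≤deg = begin
    size X' + (1 + d)                         ≤⟨ +-monoʳ-≤ (size X') (+-monoʳ-≤ 1 d≤deg) ⟩
    size X' + (1 + deg X v)                   ≡⟨ cong (λ s → size X' + (s + deg X v)) (ΣF-δ v) ⟨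
    size X' + (ΣF (δ v) + deg X v)            ≡⟨ cong (size X' +_) (ΣF-+ (δ v) nbr) ⟨
    size X' + ΣF (λ w → δ v w + nbr w)        ≡⟨ ΣF-+ (λ w → ind (lookup X' w)) (λ w → δ v w + nbr w) ⟨
    ΣF (λ w → ind (lookup X' w) + (δ v w + nbr w)) ≤⟨ ΣF-mono pointwise ⟩
    size X                                    ∎
    where
    open ≤-Reasoning
    X' = remove X v true
    nbr : Fin n → ℕ
    nbr w = ind (lookup X w ∧ adj G v w)
    pointwise : ∀ w → ind (lookup X' w) + (δ v w + nbr w) ≤ ind (lookup X w)
    pointwise w rewrite remove-lookup X v true w with w ≟ᶠ v
    ... | yes refl rewrite v∈X | Graph.irrefl G w = ≤-refl
    ... | no _ with lookup X w | adj G v w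
    ...   | false | _     = ≤-refl
    ...   | true  | true  = ≤-refl
    ...   | true  | false = ≤-refl

  size-remove-out : ∀ X v → v ∈ᵇ X → size (remove X v false) + 1 ≤ size X
  size-remove-out X v v∈X = begin
    size X' + 1                          ≡⟨ cong (size X' +_) (ΣF-δ v) ⟨
    size X' + ΣF (δ v)                   ≡⟨ ΣF-+ (λ w → ind (lookup X' w)) (δ v) ⟨
    ΣF (λ w → ind (lookup X' w) + δ v w) ≤⟨ ΣF-mono pointwise ⟩
    size X                               ∎
    where
    open ≤-Reasoning
    X' = remove X v false
    pointwise : ∀ w → ind (lookup X' w) + δ v w ≤ ind (lookup X w)
    pointwise w rewrite remove-lookup X v false w with w ≟ᶠ v
    ... | yes refl rewrite v∈X = ≤-refl
    ... | no _ with lookup X w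
    ...   | false = ≤-refl
    ...   | true  = ≤-refl

  record Nbr (X : Subset n) (v u : Fin n) : Set where
    constructor nbr
    field
      nbr-∈   : u ∈ᵇ X
      nbr-adj : adj G v u ≡ true
  open Nbr public

  nbr⇒summand : ∀ {X v u} → Nbr X v u → (lookup X u ∧ adj G v u) ≡ true
  nbr⇒summand (nbr u∈X vu) rewrite u∈X | vu = refl

  summand⇒nbr : ∀ {X v u} → (lookup X u ∧ adj G v u) ≡ true → Nbr X v u
  summand⇒nbr s = nbr (proj₁ (∧-true s)) (proj₂ (∧-true s))

  nbr-sym : ∀ {X v u} → v ∈ᵇ X → Nbr X v u → Nbr X u v
  nbr-sym {v = v} {u} v∈X vu = nbr v∈X (adj-sym v u (nbr-adj vu))

  nbr⇒deg≥1 : ∀ {X v u} → Nbr X v u → 1 ≤ deg X v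
  nbr⇒deg≥1 {X} {v} {u} vu =
    ≤-trans (≤-reflexive (cong ind (sym (nbr⇒summand vu)))) (ΣF-point (λ w → ind (lookup X w ∧ adj G v w)) u)

  deg≥1⇒nbr : ∀ X v → 1 ≤ deg X v → Σ (Fin n) (Nbr X v)
  deg≥1⇒nbr X v 1≤deg with search (λ w → lookup X w ∧ adj G v w)
  ... | inj₁ (u , s) = u , summand⇒nbr s
  ... | inj₂ none    = ⊥-elim (<⇒≱ 1≤deg (≤-reflexive (ΣF-zero _ (λ w → cong ind (none w)))))

  distinct-nbrs : ∀ X v (ws : List (Fin n)) → AllPairs _≢_ ws → All (Nbr X v) ws → length ws ≤ deg X v
  distinct-nbrs X v ws distinct nbrs =
    ΣF-distinct ws _ distinct (All.map (λ vw → ≤-reflexive (cong ind (sym (nbr⇒summand vw)))) nbrs)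

  second-nbr : ∀ X v a → 2 ≤ deg X v → Nbr X v a → Σ (Fin n) λ u → Nbr X v u × u ≢ a
  second-nbr X v a 2≤deg va with search (λ w → (lookup X w ∧ adj G v w) ∧ not ⌊ w ≟ᶠ a ⌋)
  ... | inj₁ (u , found) = u , summand⇒nbr (proj₁ (∧-true found)) , u≢a (proj₂ (∧-true found))
    where
    u≢a : not ⌊ u ≟ᶠ a ⌋ ≡ true → u ≢ a
    u≢a ne u≡a with u ≟ᶠ a
    ... | yes _   = true≢false (sym ne)
    ... | no  u≢a = u≢a u≡a
  ... | inj₂ none = ⊥-elim (<⇒≱ 2≤deg (≤-trans (ΣF-mono only-a) (≤-reflexive (ΣF-δ a))))
    where
    only-a : ∀ w → ind (lookup X w ∧ adj G v w) ≤ δ a w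
    only-a w with none w
    ... | nw with w ≟ᶠ a | lookup X w ∧ adj G v w
    ...   | yes _ | b     = ind≤1 b
    ...   | no  _ | false = z≤n

  unique-nbr : ∀ X v a w → deg X v ≤ 1 → Nbr X v a → Nbr X v w → w ≡ a
  unique-nbr X v a w deg≤1 va vw with w ≟ᶠ a
  ... | yes w≡a = w≡a
  ... | no  w≢a = ⊥-elim (<⇒≱ (s≤s deg≤1)
          (distinct-nbrs X v (a ∷ w ∷ []) (((λ a≡w → w≢a (sym a≡w)) ∷ []) ∷ [] ∷ []) (va ∷ vw ∷ [])))

  two-nbrs : ∀ X v a b w → deg X v ≤ 2 → Nbr X v a → Nbr X v b → a ≢ b → Nbr X v w → w ≡ a ⊎ w ≡ b
  two-nbrs X v a b w deg≤2 va vb a≢b vw with w ≟ᶠ a | w ≟ᶠ b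
  ... | yes w≡a | _       = inj₁ w≡a
  ... | no _    | yes w≡b = inj₂ w≡b
  ... | no w≢a  | no w≢b  = ⊥-elim (<⇒≱ (s≤s deg≤2) (distinct-nbrs X v (a ∷ b ∷ w ∷ [])
          ((a≢b ∷ (λ a≡w → w≢a (sym a≡w)) ∷ []) ∷ ((λ b≡w → w≢b (sym b≡w)) ∷ []) ∷ [] ∷ [])
          (va ∷ vb ∷ vw ∷ [])))

-- Families of maximal independent sets, seen through a vertex set X

module Traces {n : ℕ} (G : Graph n) where
  open VertexSets G

  -- J ∩ X is a maximal independent set of G[X]
  record MaxIndIn (X J : Subset n) : Set where
    constructor max-ind-in
    field
      independent : ∀ u w → u ∈ᵇ X → w ∈ᵇ X → u ∈ᵇ J → w ∈ᵇ J → adj G u w ≡ false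
      dominating  : ∀ w → w ∈ᵇ X → lookup J w ≡ false →
                    Σ (Fin n) λ u → u ∈ᵇ X × u ∈ᵇ J × adj G w u ≡ true
  open MaxIndIn public

  AgreeOutside : Subset n → Subset n → Subset n → Set
  AgreeOutside X I J = ∀ w → lookup X w ≡ false → lookup I w ≡ lookup J w

  -- distinct sets, agreeing outside X, whose traces on X are maximal
  -- independent in G[X]; the traces are then distinct, and the number of
  -- members is at most the number of maximal independent sets of G[X]
  record Family (X : Subset n) (L : List (Subset n)) : Set where
    constructor family
    field
      traces    : All (MaxIndIn X) L
      separated : AllPairs (λ I J → I ≢ J × AgreeOutside X I J) L
  open Family public

  -- a maximal independent set dominates every vertex outside it: otherwise
  -- adding the vertex would leave it independent
  maximal-dominates : ∀ I → MaximalIndependent G I → ∀ w → lookup I w ≡ false →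
                      Σ (Fin n) λ u → u ∈ᵇ I × adj G w u ≡ true
  maximal-dominates I (indep , maximal) w w∉I with search (λ u → lookup I u ∧ adj G w u)
  ... | inj₁ (u , s) = u , ∧-true s
  ... | inj₂ none    = ⊥-elim (true≢false (trans (sym ([]=⇒lookup w∈I)) w∉I))
    where
    nonadj : ∀ u → u ∈ I → adj G w u ≡ false
    nonadj u u∈I = subst (λ b → (b ∧ adj G w u) ≡ false) ([]=⇒lookup u∈I) (none u)
    I+w-indep : Independent G (I ∪ ⁅ w ⁆)
    I+w-indep u v u∈ v∈ with x∈p∪q⁻ I ⁅ w ⁆ u∈ | x∈p∪q⁻ I ⁅ w ⁆ v∈
    ... | inj₁ u∈I | inj₁ v∈I = indep u v u∈I v∈I
    ... | inj₁ u∈I | inj₂ v∈w rewrite x∈⁅y⁆⇒x≡y w v∈w = trans (Graph.sym G u w) (nonadj u u∈I)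
    ... | inj₂ u∈w | inj₁ v∈I rewrite x∈⁅y⁆⇒x≡y w u∈w = nonadj v v∈I
    ... | inj₂ u∈w | inj₂ v∈w rewrite x∈⁅y⁆⇒x≡y w u∈w | x∈⁅y⁆⇒x≡y w v∈w = Graph.irrefl G w
    w∈I : w ∈ I
    w∈I = maximal (I ∪ ⁅ w ⁆) I+w-indep (p⊆p∪q ⁅ w ⁆) (x∈p∪q⁺ (inj₂ (x∈⁅x⁆ w)))

  nbr-∉ : ∀ {X v w J} → v ∈ᵇ X → w ∈ᵇ X → v ∈ᵇ J → adj G v w ≡ true → MaxIndIn X J → lookup J w ≡ false
  nbr-∉ {X} {v} {w} {J} v∈X w∈X v∈J vw M with lookup J w in w∈J
  ... | false = refl
  ... | true  = ⊥-elim (true≢false (trans (sym vw) (independent M v w v∈X w∈X v∈J w∈J)))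

  trace-in : ∀ {X v J} → v ∈ᵇ X → v ∈ᵇ J → MaxIndIn X J → MaxIndIn (remove X v true) J
  trace-in {X} {v} {J} v∈X v∈J M = max-ind-in
    (λ u w u∈ w∈ → independent M u w (remove-⊆ X v true u u∈) (remove-⊆ X v true w w∈))
    dominated
    where
    dominated : ∀ w → w ∈ᵇ remove X v true → lookup J w ≡ false →
                Σ (Fin n) λ u → u ∈ᵇ remove X v true × u ∈ᵇ J × adj G w u ≡ true
    dominated w w∈ w∉J with dominating M w (remove-⊆ X v true w w∈) w∉J
    ... | u , u∈X , u∈J , wu = u , remove-keep X v true u u∈X u≢v (λ _ → independent M v u v∈X u∈X v∈J u∈J) , u∈J , wu
      where
      u≢v : u ≢ v
      u≢v refl = true≢false (trans (sym (adj-sym w u wu)) (remove-nonadj X v w w∈))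

  trace-out : ∀ {X v J} → lookup J v ≡ false → MaxIndIn X J → MaxIndIn (remove X v false) J
  trace-out {X} {v} {J} v∉J M = max-ind-in
    (λ u w u∈ w∈ → independent M u w (remove-⊆ X v false u u∈) (remove-⊆ X v false w w∈))
    dominated
    where
    dominated : ∀ w → w ∈ᵇ remove X v false → lookup J w ≡ false →
                Σ (Fin n) λ u → u ∈ᵇ remove X v false × u ∈ᵇ J × adj G w u ≡ true
    dominated w w∈ w∉J with dominating M w (remove-⊆ X v false w w∈) w∉J
    ... | u , u∈X , u∈J , wu = u , remove-keep X v false u u∈X u≢v (λ ()) , u∈J , wu
      where
      u≢v : u ≢ v
      u≢v refl = true≢false (trans (sym u∈J) v∉J)

  agree-in : ∀ {X v I J} → v ∈ᵇ X → v ∈ᵇ I → v ∈ᵇ J → MaxIndIn X I → MaxIndIn X J →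
             AgreeOutside X I J → AgreeOutside (remove X v true) I J
  agree-in {X} {v} v∈X v∈I v∈J MI MJ agree w w∉ with remove-gone X v true w w∉
  ... | inj₁ w∉X                = agree w w∉X
  ... | inj₂ (inj₁ refl)        = trans v∈I (sym v∈J)
  ... | inj₂ (inj₂ (_ , vw)) with lookup X w in w∈X
  ...   | false = agree w w∈X
  ...   | true  = trans (nbr-∉ v∈X w∈X v∈I vw MI) (sym (nbr-∉ v∈X w∈X v∈J vw MJ))

  agree-out : ∀ {X v I J} → lookup I v ≡ false → lookup J v ≡ false →
              AgreeOutside X I J → AgreeOutside (remove X v false) I J
  agree-out {X} {v} v∉I v∉J agree w w∉ with remove-gone X v false w w∉
  ... | inj₁ w∉X         = agree w w∉X
  ... | inj₂ (inj₁ refl) = trans v∉I (sym v∉J)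
  ... | inj₂ (inj₂ (() , _))

  family-select : ∀ {X L} v b → Family X L → Family X (select v b L)
  family-select v b (family tr sep) =
    family (All-filter⁺ (λ J → lookup J v ≟ᵇ b) tr) (AllPairs-filter⁺ (λ J → lookup J v ≟ᵇ b) sep)

  family-in : ∀ {X L} v → v ∈ᵇ X → Family X L → Family (remove X v true) (select v true L)
  family-in {X} {L} v v∈X F = family
    (All.map (λ {J} (v∈J , MJ) → trace-in {X} {v} {J} v∈X v∈J MJ) known)
    (allPairs-with known (separated (family-select v true F))
      (λ {I} {J} (v∈I , MI) (v∈J , MJ) (I≢J , agree) → I≢J , agree-in {X} {v} {I} {J} v∈X v∈I v∈J MI MJ agree))
    where
    known = All.zip (select-all v true L , traces (family-select v true F))

  family-out : ∀ {X L} v → Family X L → Family (remove X v false) (select v false L)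
  family-out {X} {L} v F = family
    (All.map (λ {J} (v∉J , MJ) → trace-out {X} {v} {J} v∉J MJ) known)
    (allPairs-with known (separated (family-select v false F))
      (λ {I} {J} (v∉I , _) (v∉J , _) (I≢J , agree) → I≢J , agree-out {X} {v} {I} {J} v∉I v∉J agree))
    where
    known = All.zip (select-all v false L , traces (family-select v false F))

  -- with X = ∅ all members agree everywhere, so there is at most one
  family-∅ : ∀ {X L} → (∀ w → lookup X w ≡ false) → Family X L → length L ≤ 1
  family-∅ {L = []}          X≡∅ F = z≤n
  family-∅ {L = I ∷ []}      X≡∅ F = ≤-refl
  family-∅ {L = I ∷ J ∷ L} X≡∅ (family _ (((I≢J , agree) ∷ _) ∷ _)) =
    ⊥-elim (I≢J (trans (sym (tabulate∘lookup I))
                  (trans (tabulate-cong (λ w → agree w (X≡∅ w))) (tabulate∘lookup J))))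

-- The Hujter–Tuza bound: in a triangle-free graph a family for X has at
-- most √2^|X| members.

module HujterTuza {n : ℕ} (G : Graph n) (triangle-free : TriangleFree G) where
  open VertexSets G
  open Traces G

  HTBound : ℕ → Set
  HTBound m = ∀ X L → size X ≤ m → Family X L → length L ≼ √2^ m

  Smaller : ℕ → Set
  Smaller m = ∀ {m'} → m' < m → HTBound m'

  recurse : ∀ k {m₀} X {Y L} → Smaller (suc k + m₀) → size Y + suc k ≤ size X → size X ≤ suc k + m₀ →
            Family Y L → length L ≼ √2^ m₀
  recurse k {m₀} X {Y} IH shrink sz = IH (s≤s (m≤n+m m₀ k)) Y _ (shrink-≤ shrink sz)

  forced-∈ : ∀ {X J v} → v ∈ᵇ X → MaxIndIn X J → (∀ u → Nbr X v u → lookup J u ≡ false) → lookup J v ≡ true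
  forced-∈ {X} {J} {v} v∈X M no-nbr with lookup J v in v∈J
  ... | true  = refl
  ... | false with dominating M v v∈X v∈J
  ...   | u , u∈X , u∈J , vu = ⊥-elim (true≢false (trans (sym u∈J) (no-nbr u (nbr u∈X vu))))

  case-empty : ∀ m {X L} → (∀ w → lookup X w ≡ false) → Family X L → length L ≼ √2^ m
  case-empty m X≡∅ F = ≼-monoˡ (family-∅ X≡∅ F) (1≼√2^ m)

  -- an isolated vertex v lies in every member: delete it and recurse
  case-isolated : ∀ m → Smaller m → ∀ X L v → v ∈ᵇ X → deg X v ≡ 0 → size X ≤ m → Family X L → length L ≼ √2^ m
  case-isolated m IH X L v v∈X deg≡0 sz F with shifted 1 (drop-≤ (size-remove-in X v v∈X 0 z≤n) sz)
  ... | m₀ , refl = subst (λ L' → length L' ≼ √2^ (1 + m₀)) (select-forced v true forced)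
                      (≼-√2^-suc m₀ (recurse 0 X IH (size-remove-in X v v∈X 0 z≤n) sz (family-in v v∈X F)))
    where
    forced : All (λ J → lookup J v ≡ true) L
    forced = All.map (λ M → forced-∈ v∈X M (λ u vu → ⊥-elim (<⇒≱ (nbr⇒deg≥1 vu) (≤-reflexive deg≡0))))
                     (traces F)

  -- a vertex v with a single neighbour u: members contain v, or else u
  case-leaf : ∀ m → Smaller m → ∀ X L v → v ∈ᵇ X → deg X v ≡ 1 → size X ≤ m → Family X L → length L ≼ √2^ m
  case-leaf m IH X L v v∈X deg≡1 sz F with deg≥1⇒nbr X v (≤-reflexive (sym deg≡1))
  ... | u , vu with shifted 2 (drop-≤ (size-remove-in X v v∈X 1 (≤-reflexive (sym deg≡1))) sz)
  ...   | m₀ , refl = ≼-monoˡ split (≼-√2^-double m₀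
                        (recurse 1 X IH (size-remove-in X v v∈X 1 (≤-reflexive (sym deg≡1))) sz (family-in v v∈X F))
                        (recurse 1 X IH (size-remove-in X u u∈X 1 (nbr⇒deg≥1 uv)) sz (family-in u u∈X F₀)))
    where
    u∈X = nbr-∈ vu
    uv = nbr-sym v∈X vu
    L₀ = select v false L
    F₀ = family-select v false F
    u∈ : All (λ J → lookup J u ≡ true) L₀
    u∈ = All.zipWith (λ {J} (v∉J , M) → u-dominates v∉J M) (select-all v false L , traces F₀)
      where
      u-dominates : ∀ {J} → lookup J v ≡ false → MaxIndIn X J → lookup J u ≡ true
      u-dominates {J} v∉J M with dominating M v v∈X v∉J
      ... | w , w∈X , w∈J , vw = subst (λ z → lookup J z ≡ true) (unique-nbr X v u w (≤-reflexive deg≡1) vu (nbr w∈X vw)) w∈J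
    split : length L ≤ length (select v true L) + length (select u true L₀)
    split = ≤-trans (select-split v L)
                    (+-monoʳ-≤ _ (≤-reflexive (cong length (sym (select-forced u true u∈)))))

  -- a vertex v of degree ≥ 3: members contain v (delete ≥ 4 vertices) or not (delete 1)
  case-heavy : ∀ m → Smaller m → ∀ X L v → v ∈ᵇ X → 3 ≤ deg X v → size X ≤ m → Family X L → length L ≼ √2^ m
  case-heavy m IH X L v v∈X 3≤deg sz F with shifted 4 (drop-≤ (size-remove-in X v v∈X 3 3≤deg) sz)
  ... | m₀ , refl = ≼-monoˡ (select-split v L) (≼-√2^-branch m₀
                      (recurse 3 X IH (size-remove-in X v v∈X 3 3≤deg) sz (family-in v v∈X F))
                      (recurse 0 X IH (size-remove-out X v v∈X) sz (family-out v F)))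

  -- every vertex of X has degree 2 (X spans disjoint cycles, of length ≥ 4
  -- as G is triangle-free): v has neighbours a ≠ b, and a' ≠ v is the other
  -- neighbour of a. Members contain a, or v, or else both a' and b.
  module CycleCase (X : Subset n) (L : List (Subset n)) (F : Family X L) (v a b a' : Fin n)
    (v∈X : v ∈ᵇ X) (deg-v : deg X v ≡ 2) (va : Nbr X v a) (vb : Nbr X v b) (a≢b : a ≢ b)
    (deg-a : deg X a ≡ 2) (aa' : Nbr X a a') (a'≢v : a' ≢ v) where

    a∈X = nbr-∈ va
    b∈X = nbr-∈ vb
    a'∈X = nbr-∈ aa'

    L₁ = select a true L
    Lᵣ = select a false L
    L₂ = select v true Lᵣ
    L₃ = select v false Lᵣ
    Fᵣ = family-select a false F
    F₃ = family-select v false Fᵣ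

    shrink₁ : size (remove X a true) + 3 ≤ size X
    shrink₁ = size-remove-in X a a∈X 2 (≤-reflexive (sym deg-a))

    shrink₂ : size (remove X v true) + 3 ≤ size X
    shrink₂ = size-remove-in X v v∈X 2 (≤-reflexive (sym deg-v))

    split : length L ≤ length L₁ + (length L₂ + length L₃)
    split = ≤-trans (select-split a L) (+-monoʳ-≤ (length L₁) (select-split v Lᵣ))

    -- members of L₃ avoid a and v, so a' and b dominate them
    avoid : All (λ J → lookup J a ≡ false × lookup J v ≡ false × MaxIndIn X J) L₃
    avoid = All.zipWith (λ (v∉ , a∉ , M) → a∉ , v∉ , M)
              (select-all v false Lᵣ , All.zip (All-filter⁺ _ (select-all a false L) , traces F₃))

    a'∈₃ : All (λ J → lookup J a' ≡ true) L₃
    a'∈₃ = All.map (λ {J} (a∉J , v∉J , M) → a'-dominates {J} a∉J v∉J M) avoid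
      where
      a'-dominates : ∀ {J} → lookup J a ≡ false → lookup J v ≡ false → MaxIndIn X J → lookup J a' ≡ true
      a'-dominates {J} a∉J v∉J M with dominating M a a∈X a∉J
      ... | u , u∈X , u∈J , au with two-nbrs X a v a' u (≤-reflexive deg-a) (nbr-sym v∈X va) aa'
                                      (λ v≡a' → a'≢v (sym v≡a')) (nbr u∈X au)
      ...   | inj₁ refl = ⊥-elim (true≢false (trans (sym u∈J) v∉J))
      ...   | inj₂ refl = u∈J

    b∈₃ : All (λ J → lookup J b ≡ true) L₃
    b∈₃ = All.map (λ {J} (a∉J , v∉J , M) → b-dominates {J} a∉J v∉J M) avoid
      where
      b-dominates : ∀ {J} → lookup J a ≡ false → lookup J v ≡ false → MaxIndIn X J → lookup J b ≡ true
      b-dominates {J} a∉J v∉J M with dominating M v v∈X v∉J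
      ... | u , u∈X , u∈J , vu with two-nbrs X v a b u (≤-reflexive deg-v) va vb a≢b (nbr u∈X vu)
      ...   | inj₁ refl = ⊥-elim (true≢false (trans (sym u∈J) a∉J))
      ...   | inj₂ refl = u∈J

    -- if a'b is an edge then L₃ = ∅, and |L| ≤ 2 √2^(m−3) ≤ √2^m
    bound-adjacent : adj G a' b ≡ true → ∀ m → Smaller m → size X ≤ m → length L ≼ √2^ m
    bound-adjacent a'b m IH sz with shifted 3 (drop-≤ shrink₁ sz)
    ... | m₀ , refl = ≼-monoˡ split' (≼-√2^-suc (2 + m₀) (≼-√2^-double m₀
                        (recurse 2 X IH shrink₁ sz (family-in a a∈X F))
                        (recurse 2 X IH shrink₂ sz (family-in v v∈X Fᵣ))))
      where
      L₃-empty : length L₃ ≡ 0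
      L₃-empty = all-absurd (λ (a'∈J , b∈J , M) → true≢false (trans (sym a'b) (independent M a' b a'∈X b∈X a'∈J b∈J)))
                   (All.zipWith id (a'∈₃ , All.zip (b∈₃ , traces F₃)))
      split' : length L ≤ length L₁ + length L₂
      split' = ≤-trans split (≤-reflexive (cong (length L₁ +_) (trans (cong (length L₂ +_) L₃-empty) (+-identityʳ _))))

    -- otherwise members of L₃ contain a' and b; deleting N[a'] and then N[b]
    -- removes ≥ 4 vertices, and |L| ≤ √2^(m−4) + 2 √2^(m−3) ≤ √2^m
    module NonAdjacent (a'b : adj G a' b ≡ false) where
      X' = remove X a' true

      b≢a' : b ≢ a'
      b≢a' refl = triangle-free v a b (nbr-adj va) (nbr-adj aa') (nbr-adj vb)

      a'v : adj G a' v ≡ false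
      a'v with adj G a' v in e
      ... | false = refl
      ... | true  = ⊥-elim (triangle-free a a' v (nbr-adj aa') e (adj-sym v a (nbr-adj va)))

      b∈X' : b ∈ᵇ X'
      b∈X' = remove-keep X a' true b b∈X b≢a' (λ _ → a'b)

      v∈X' : v ∈ᵇ X'
      v∈X' = remove-keep X a' true v v∈X (λ v≡a' → a'≢v (sym v≡a')) (λ _ → a'v)

      shrink₃ : size (remove X' b true) + 4 ≤ size X
      shrink₃ = begin
        size (remove X' b true) + 4       ≡⟨ +-assoc (size (remove X' b true)) 2 2 ⟨
        size (remove X' b true) + 2 + 2   ≤⟨ +-monoˡ-≤ 2 (size-remove-in X' b b∈X' 1 (nbr⇒deg≥1 (nbr-sym {X'} v∈X' (nbr b∈X' (nbr-adj vb))))) ⟩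
        size X' + 2                       ≤⟨ size-remove-in X a' a'∈X 1 (nbr⇒deg≥1 (nbr-sym a∈X aa')) ⟩
        size X                            ∎
        where open ≤-Reasoning

      L₃' = select b true (select a' true L₃)

      split' : length L ≤ length L₃' + (length L₁ + length L₂)
      split' = ≤-trans split (≤-trans (+-monoʳ-≤ (length L₁) (+-monoʳ-≤ (length L₂) (≤-reflexive (cong length L₃≡))))
                 (≤-reflexive (trans (sym (+-assoc (length L₁) (length L₂) (length L₃'))) (+-comm (length L₁ + length L₂) (length L₃')))))
        where
        L₃≡ : L₃ ≡ L₃'
        L₃≡ = sym (trans (cong (select b true) (select-forced a' true a'∈₃)) (select-forced b true b∈₃))

      bound-nonadjacent : ∀ m → Smaller m → size X ≤ m → length L ≼ √2^ m
      bound-nonadjacent m IH sz with shifted 4 (drop-≤ shrink₃ sz)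
      ... | m₀ , refl = ≼-monoˡ split' (≼-√2^-branch m₀
                          (recurse 3 X IH shrink₃ sz (family-in b b∈X' (family-in a' a'∈X F₃)))
                          (≼-√2^-double (1 + m₀) (recurse 2 X IH shrink₁ sz (family-in a a∈X F))
                                                 (recurse 2 X IH shrink₂ sz (family-in v v∈X Fᵣ))))

    bound : ∀ m → Smaller m → size X ≤ m → length L ≼ √2^ m
    bound with adj G a' b in a'b
    ... | true  = bound-adjacent a'b
    ... | false = NonAdjacent.bound-nonadjacent a'b

  case-cycle : ∀ m → Smaller m → ∀ X L → (∀ w → w ∈ᵇ X → deg X w ≡ 2) → ∀ v → v ∈ᵇ X →
               size X ≤ m → Family X L → length L ≼ √2^ m
  case-cycle m IH X L deg≡2 v v∈X sz F =
    CycleCase.bound X L F v a b a' v∈X (deg≡2 v v∈X) va vb a≢b (deg≡2 a a∈X) aa' a'≢v m IH sz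
    where
    two : ∀ {w} → w ∈ᵇ X → 2 ≤ deg X w
    two w∈X = ≤-reflexive (sym (deg≡2 _ w∈X))
    a = proj₁ (deg≥1⇒nbr X v (≤-trans (s≤s z≤n) (two v∈X)))
    va = proj₂ (deg≥1⇒nbr X v (≤-trans (s≤s z≤n) (two v∈X)))
    a∈X = nbr-∈ va
    b = proj₁ (second-nbr X v a (two v∈X) va)
    vb = proj₁ (proj₂ (second-nbr X v a (two v∈X) va))
    a≢b : a ≢ b
    a≢b a≡b = proj₂ (proj₂ (second-nbr X v a (two v∈X) va)) (sym a≡b)
    a' = proj₁ (second-nbr X a v (two a∈X) (nbr-sym v∈X va))
    aa' = proj₁ (proj₂ (second-nbr X a v (two a∈X) (nbr-sym v∈X va)))
    a'≢v = proj₂ (proj₂ (second-nbr X a v (two a∈X) (nbr-sym v∈X va)))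

  ht-step : ∀ m → Smaller m → HTBound m
  ht-step m IH X L sz F with find (λ v → (lookup X v ≟ᵇ true) ×-dec (3 ≤? deg X v))
  ... | inj₁ (v , v∈X , 3≤deg) = case-heavy m IH X L v v∈X 3≤deg sz F
  ... | inj₂ no-heavy with find (λ v → (lookup X v ≟ᵇ true) ×-dec (deg X v ≟ 0))
  ...   | inj₁ (v , v∈X , deg≡0) = case-isolated m IH X L v v∈X deg≡0 sz F
  ...   | inj₂ no-isolated with find (λ v → (lookup X v ≟ᵇ true) ×-dec (deg X v ≟ 1))
  ...     | inj₁ (v , v∈X , deg≡1) = case-leaf m IH X L v v∈X deg≡1 sz F
  ...     | inj₂ no-leaf with search (lookup X)
  ...       | inj₂ X≡∅       = case-empty m X≡∅ F
  ...       | inj₁ (v , v∈X) = case-cycle m IH X L deg≡2 v v∈X sz F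
    where
    deg≡2 : ∀ w → w ∈ᵇ X → deg X w ≡ 2
    deg≡2 w w∈X with deg X w | ≰⇒> (λ 3≤d → no-heavy w (w∈X , 3≤d)) | no-isolated w | no-leaf w
    ... | 0 | _ | ¬0 | _  = ⊥-elim (¬0 (w∈X , refl))
    ... | 1 | _ | _  | ¬1 = ⊥-elim (¬1 (w∈X , refl))
    ... | 2 | _ | _  | _  = refl
    ... | suc (suc (suc _)) | s≤s (s≤s (s≤s ())) | _ | _

  ht : ∀ m → HTBound m
  ht = <-rec HTBound ht-step

module Run {n : ℕ} (G : Graph n) (ρ : Permutation′ n) where
  open VertexSets G

  -- Process.pick is a fold over the vertices; its step function is local
  -- to Defs, and is named here by unification with the definition
  pick-step : Subset n → Subset n → Fin n → Maybe (Fin n) → Maybe (Fin n)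
  pick-foldr : ∀ I X → Process.pick G ρ I X ≡ foldr (pick-step I X) nothing (allFin n)
  pick-step I X = _
  pick-foldr I X = refl

  pick-indep : ∀ I J X → Process.pick G ρ I X ≡ Process.pick G ρ J X
  pick-indep I J X = trans (pick-foldr I X) (trans (fold (allFin n)) (sym (pick-foldr J X)))
    where
    step-indep : ∀ v acc → pick-step I X v acc ≡ pick-step J X v acc
    step-indep v acc with lookup X v
    ... | false = refl
    ... | true with acc
    ...   | nothing = refl
    ...   | just b  = refl
    fold : ∀ l → foldr (pick-step I X) nothing l ≡ foldr (pick-step J X) nothing l
    fold []      = refl
    fold (v ∷ l) = trans (step-indep v _) (cong (pick-step J X v) (fold l))

  process-deg : ∀ I X v → Process.deg G ρ I X v ≡ deg X v
  process-deg I X v = sum-tabulate (λ w → ind (lookup X w ∧ adj G v w)) id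
    where
    sum-tabulate : ∀ {k m} (f : Fin m → ℕ) (g : Fin k → Fin m) →
                   sum (map f (Data.List.tabulate g)) ≡ ΣF (f ∘ g)
    sum-tabulate {zero}  f g = refl
    sum-tabulate {suc k} f g = cong (f (g zero) +_) (sum-tabulate f (g ∘ suc))

  -- the fold's result after scanning the list l
  Best : Subset n → Maybe (Fin n) → List (Fin n) → Set
  Best X nothing  l = All (λ w → lookup X w ≡ false) l
  Best X (just x) l = x ∈ᵇ X × All (λ w → w ∈ᵇ X → deg X w ≤ deg X x) l

  if-cases : ∀ {A : Set} (P : A → Set) c {x y} → (c ≡ true → P x) → (c ≡ false → P y) → P (if c then x else y)
  if-cases P true  t f = t refl
  if-cases P false t f = f refl

  preferred : ∀ dv db r → ((db <ᵇ dv) ∨ ((dv ≡ᵇ db) ∧ r)) ≡ true → db ≤ dv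
  preferred dv db r pref with db <ᵇ dv in lt
  ... | true = <⇒≤ (<ᵇ⇒< db dv (subst T (sym lt) tt))
  ... | false with dv ≡ᵇ db in eq
  ...   | true  = ≤-reflexive (sym (≡ᵇ⇒≡ dv db (subst T (sym eq) tt)))
  ...   | false = ⊥-elim (true≢false (sym pref))

  not-preferred : ∀ dv db r → ((db <ᵇ dv) ∨ ((dv ≡ᵇ db) ∧ r)) ≡ false → dv ≤ db
  not-preferred dv db r pref with db <ᵇ dv in lt
  ... | true  = ⊥-elim (true≢false pref)
  ... | false = ≮⇒≥ (λ db<dv → subst T lt (<⇒<ᵇ db<dv))

  best-step : ∀ I X v acc l → Best X acc l → Best X (pick-step I X v acc) (v ∷ l)
  best-step I X v acc l best with lookup X v in v∈X
  ... | false with acc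
  ...   | nothing = v∈X ∷ best
  ...   | just x  = proj₁ best , (λ v∈ → ⊥-elim (true≢false (trans (sym v∈) v∈X))) ∷ proj₂ best
  best-step I X v acc l best | true with acc
  ...   | nothing = v∈X , (λ _ → ≤-refl) ∷ All.map (λ w∉X w∈X → ⊥-elim (true≢false (trans (sym w∈X) w∉X))) best
  ...   | just b  = if-cases (λ r → Best X r (v ∷ l)) _ take-v keep-b
    where
    dX = Process.deg G ρ I X
    take-v : _ ≡ true → Best X (just v) (v ∷ l)
    take-v pref = v∈X , (λ _ → ≤-refl) ∷ All.map (λ w≤b w∈X → ≤-trans (w≤b w∈X) b≤v) (proj₂ best)
      where
      b≤v : deg X b ≤ deg X v
      b≤v = subst₂ _≤_ (process-deg I X b) (process-deg I X v) (preferred (dX v) (dX b) _ pref)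
    keep-b : _ ≡ false → Best X (just b) (v ∷ l)
    keep-b pref = proj₁ best , (λ _ → v≤b) ∷ proj₂ best
      where
      v≤b : deg X v ≤ deg X b
      v≤b = subst₂ _≤_ (process-deg I X v) (process-deg I X b) (not-preferred (dX v) (dX b) _ pref)

  best-pick : ∀ I X → Best X (Process.pick G ρ I X) (allFin n)
  best-pick I X = subst (λ r → Best X r (allFin n)) (sym (pick-foldr I X)) (fold (allFin n))
    where
    fold : ∀ l → Best X (foldr (pick-step I X) nothing l) l
    fold []      = []
    fold (v ∷ l) = best-step I X v _ l (fold l)

  pick-just : ∀ I X x → Process.pick G ρ I X ≡ just x → x ∈ᵇ X × (∀ w → w ∈ᵇ X → deg X w ≤ deg X x)
  pick-just I X x picked with Process.pick G ρ I X | best-pick I X | picked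
  ... | just .x | x∈X , max-x | refl = x∈X , λ w → All.lookup max-x (∈-allFin w)

  pick-nothing : ∀ I X → Process.pick G ρ I X ≡ nothing → ∀ w → lookup X w ≡ false
  pick-nothing I X none w with Process.pick G ρ I X | best-pick I X | none
  ... | nothing | X≡∅ | refl = All.lookup X≡∅ (∈-allFin w)

  all-true : ∀ {A : Set} (p : A → Bool) l → all p l ≡ true → All (λ w → p w ≡ true) l
  all-true p []      _   = []
  all-true p (w ∷ l) all-p with p w in pw
  ... | true = pw ∷ all-true p l all-p

  all-false : ∀ {A : Set} (p : A → Bool) l → all p l ≡ false → Σ A (λ w → p w ≡ false)
  all-false p (w ∷ l) not-all with p w in pw
  ... | false = w , pw
  ... | true  = all-false p l not-all

  done-true : ∀ I X → Process.done G ρ I X ≡ true → ∀ w → w ∈ᵇ X → deg X w ≤ 2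
  done-true I X done w w∈X = subst (_≤ 2) (process-deg I X w) (≤ᵇ⇒≤ _ 2 (subst T (sym small) tt))
    where
    test = λ w → not (lookup X w) ∨ (Process.deg G ρ I X w ≤ᵇ 2)
    small : (Process.deg G ρ I X w ≤ᵇ 2) ≡ true
    small with All.lookup (all-true test (allFin n) done) (∈-allFin w)
    ... | t rewrite w∈X = t

  done-false : ∀ I X → Process.done G ρ I X ≡ false → Σ (Fin n) λ w → w ∈ᵇ X × 3 ≤ deg X w
  done-false I X not-done with all-false (λ w → not (lookup X w) ∨ (Process.deg G ρ I X w ≤ᵇ 2)) (allFin n) not-done
  ... | w , test with lookup X w in w∈X
  ...   | true = w , w∈X , subst (3 ≤_) (process-deg I X w) (≰⇒> (λ ≤2 → subst T test (≤⇒≤ᵇ ≤2)))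

  steps-none : ∀ I f X → Process.pick G ρ I X ≡ nothing → Process.steps G ρ I (suc f) X ≡ 0
  steps-none I f X none with Process.pick G ρ I X
  steps-none I f X refl | nothing = refl

  steps-last : ∀ I f X x → Process.pick G ρ I X ≡ just x → Process.done G ρ I (Process.next G ρ I X x) ≡ true →
               Process.steps G ρ I (suc f) X ≡ 1
  steps-last I f X x picked done with Process.pick G ρ I X | picked
  ... | just .x | refl with Process.done G ρ I (Process.next G ρ I X x) | done
  ...   | true | refl = refl

  steps-continue : ∀ I f X x → Process.pick G ρ I X ≡ just x → Process.done G ρ I (Process.next G ρ I X x) ≡ false →
                   Process.steps G ρ I (suc f) X ≡ suc (Process.steps G ρ I f (Process.next G ρ I X x))
  steps-continue I f X x picked not-done with Process.pick G ρ I X | picked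
  ... | just .x | refl with Process.done G ρ I (Process.next G ρ I X x) | not-done
  ...   | false | refl = refl

  -- the termination test (Process.done does not depend on I)
  done : Subset n → Bool
  done = Process.done G ρ ∅

  done-⊆ : ∀ X Y → done X ≡ true → (∀ w → w ∈ᵇ Y → w ∈ᵇ X) → done Y ≡ true
  done-⊆ X Y done-X Y⊆X with done Y in done-Y
  ... | true  = refl
  ... | false with done-false ∅ Y done-Y
  ...   | w , w∈Y , 3≤deg = ⊥-elim (<⇒≱ (≤-trans 3≤deg (ΣF-mono fewer)) (done-true ∅ X done-X w (Y⊆X w w∈Y)))
    where
    fewer : ∀ u → ind (lookup Y u ∧ adj G w u) ≤ ind (lookup X u ∧ adj G w u)
    fewer u with lookup Y u in u∈Y
    ... | false = z≤n
    ... | true rewrite Y⊆X u u∈Y = ≤-refl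

-- A step at x (of degree
-- ≥ 3) splits the family into members containing x, continuing from
-- X − N[x] (≥ 4 vertices fewer), and the others, continuing from X − x.

module Counting {n : ℕ} (G : Graph n) (ρ : Permutation′ n) (triangle-free : TriangleFree G) where
  open VertexSets G
  open Traces G
  open HujterTuza G triangle-free
  open Run G ρ

  steps : Subset n → ℕ → Subset n → ℕ
  steps I = Process.steps G ρ I

  Heavy : Subset n → Set
  Heavy X = Σ (Fin n) λ w → w ∈ᵇ X × 3 ≤ deg X w

  Claim : ℕ → Set
  Claim T = ∀ m f X L → size X ≤ m → (T ≡ 0 ⊎ Heavy X) → Family X L →
            All (λ I → T ≤ steps I f X) L → length L * 4 ^ T ≼ β ^⊗ T ⊗ √2^ m

  0≼-length : ∀ {L : List (Subset n)} {k} x → length L ≡ 0 → length L * k ≼ x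
  0≼-length x L≡0 rewrite L≡0 = 0≼ x

  -- after the step at x, the members with (x ∈ I) = b continue from
  -- remove X x b, for T' more steps if that is not yet a stopping set
  continue : ∀ T' → Claim T' → ∀ m f X x b L → size (remove X x b) ≤ m → Family (remove X x b) L →
             All (λ I → Process.pick G ρ I X ≡ just x × lookup I x ≡ b × suc T' ≤ steps I (suc f) X) L →
             length L * 4 ^ T' ≼ β ^⊗ T' ⊗ √2^ m
  continue T' IH m f X x b L sz F runs with done (remove X x b) in stop
  ... | false = IH m f (remove X x b) L sz (inj₂ (done-false ∅ (remove X x b) stop)) F (All.map step-down runs)
    where
    step-down : ∀ {I} → Process.pick G ρ I X ≡ just x × lookup I x ≡ b × suc T' ≤ steps I (suc f) X →
                T' ≤ steps I f (remove X x b)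
    step-down {I} (picked , refl , more) =
      s≤s⁻¹ (subst (suc T' ≤_) (steps-continue I f X x picked stop) more)
  ... | true with T'
  ...   | zero    = IH m f (remove X x b) L sz (inj₁ refl) F (All.map (λ _ → z≤n) runs)
  ...   | suc T'' = 0≼-length {L} _ (all-absurd too-many runs)
    where
    too-many : ∀ {I} → ¬ (Process.pick G ρ I X ≡ just x × lookup I x ≡ b × suc (suc T'') ≤ steps I (suc f) X)
    too-many {I} (picked , refl , more) with subst (suc (suc T'') ≤_) (steps-last I f X x picked stop) more
    ... | s≤s ()

  rearrange : ∀ T' m₀ → β ^⊗ suc T' ⊗ √2^ (4 + m₀) ≡ 4 ⊙ (β ⊗ (β ^⊗ T' ⊗ √2^ m₀))
  rearrange T' m₀ = begin
    β ⊗ β ^⊗ T' ⊗ √2^ (4 + m₀)       ≡⟨ cong (β ⊗ β ^⊗ T' ⊗_) (√2^-+4 m₀) ⟩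
    β ⊗ β ^⊗ T' ⊗ (4 ⊙ √2^ m₀)       ≡⟨ ⊗-⊙ 4 (β ⊗ β ^⊗ T') (√2^ m₀) ⟩
    4 ⊙ (β ⊗ β ^⊗ T' ⊗ √2^ m₀)       ≡⟨ cong (4 ⊙_) (⊗-assoc β (β ^⊗ T') (√2^ m₀)) ⟩
    4 ⊙ (β ⊗ (β ^⊗ T' ⊗ √2^ m₀))     ∎
    where open ≡-Reasoning

  claim-step : ∀ T' → Claim T' → ∀ m₀ f X L x → (∀ I → Process.pick G ρ I X ≡ just x) → x ∈ᵇ X → 3 ≤ deg X x →
               size X ≤ 4 + m₀ → Family X L → All (λ I → suc T' ≤ steps I (suc f) X) L →
               length L * 4 ^ suc T' ≼ β ^⊗ suc T' ⊗ √2^ (4 + m₀)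
  claim-step T' IH m₀ f X L x picked x∈X 3≤deg sz F runs =
    subst (length L * 4 ^ suc T' ≼_) (sym (rearrange T' m₀)) (≼-monoˡ count (≼-⊙ 4 (≼-branch (β ^⊗ T') m₀
      (continue T' IH m₀ f X x true (select x true L) (shrink-≤ (size-remove-in X x x∈X 3 3≤deg) sz)
                (family-in x x∈X F) (members true))
      (continue T' IH (3 + m₀) f X x false (select x false L) (shrink-≤ (size-remove-out X x x∈X) sz)
                (family-out x F) (members false)))))
    where
    members : ∀ b → All (λ I → Process.pick G ρ I X ≡ just x × lookup I x ≡ b × suc T' ≤ steps I (suc f) X)
                        (select x b L)
    members b = All.zipWith (λ {I} (x∈I , more) → picked I , x∈I , more)
                  (select-all x b L , All-filter⁺ (λ J → lookup J x ≟ᵇ b) runs)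
    distrib : ∀ a b c → (a + b) * (4 * c) ≡ 4 * (a * c + b * c)
    distrib = solve-∀
    count : length L * 4 ^ suc T' ≤ 4 * (length (select x true L) * 4 ^ T' + length (select x false L) * 4 ^ T')
    count = ≤-trans (*-monoˡ-≤ (4 ^ suc T') (select-split x L)) (≤-reflexive (distrib (length (select x true L)) (length (select x false L)) (4 ^ T')))

  claim : ∀ T → Claim T
  claim zero m f X L sz _ F _ =
    subst₂ _≼_ (sym (*-identityʳ (length L))) (sym (⊗-identityˡ (√2^ m))) (ht m X L sz F)
  claim (suc T') m f X L sz (inj₁ ()) F runs
  claim (suc T') m zero X L sz (inj₂ _) F runs = 0≼-length {L} _ (all-absurd (λ ()) runs)
  claim (suc T') m (suc f) X L sz (inj₂ (w , w∈X , 3≤deg-w)) F runs with Process.pick G ρ ∅ X in picked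
  ... | nothing = ⊥-elim (true≢false (trans (sym w∈X) (pick-nothing ∅ X picked w)))
  ... | just x with pick-just ∅ X x picked
  ...   | x∈X , max-x with shifted 4 (drop-≤ (size-remove-in X x x∈X 3 (≤-trans 3≤deg-w (max-x w w∈X))) sz)
  ...     | m₀ , refl = claim-step T' (claim T') m₀ f X L x (λ I → trans (pick-indep I ∅ X) picked)
                          x∈X (≤-trans 3≤deg-w (max-x w w∈X)) sz F runs

  V : Subset n
  V = tabulate (λ _ → true)

  family-V : ∀ L → Unique L → All (MaximalIndependent G) L → Family V L
  family-V L distinct maximal = family
    (All.map (λ {I} → max-ind-in-V I) maximal)
    (AllPairs.map (λ I≢J → I≢J , λ w w∉V → ⊥-elim (true≢false (trans (sym (lookup∘tabulate _ w)) w∉V))) distinct)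
    where
    max-ind-in-V : ∀ I → MaximalIndependent G I → MaxIndIn V I
    max-ind-in-V I M = max-ind-in
      (λ u w _ _ u∈I w∈I → proj₁ M u w (lookup⇒[]= u I u∈I) (lookup⇒[]= w I w∈I))
      (λ w _ w∉I → let (u , u∈I , wu) = maximal-dominates I M w w∉I in u , lookup∘tabulate _ u , u∈I , wu)

  t≤1 : done V ≡ true → ∀ I → t G ρ I ≤ 1
  t≤1 stop I = at-most-one n
    where
    at-most-one : ∀ f → steps I f V ≤ 1
    at-most-one zero = z≤n
    at-most-one (suc f) = by-pick (Process.pick G ρ I V) refl
      where
      by-pick : ∀ r → Process.pick G ρ I V ≡ r → steps I (suc f) V ≤ 1
      by-pick nothing  picked = ≤-trans (≤-reflexive (steps-none I f V picked)) z≤n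
      by-pick (just x) picked = ≤-reflexive (steps-last I f V x picked
                                  (done-⊆ V (remove V x (lookup I x)) stop (remove-⊆ V x (lookup I x))))

  -- the case t(I) ≤ 1: the Hujter–Tuza bound suffices
  bound-short : done V ≡ true → ∀ T L → Family V L → All (λ I → T ≤ t G ρ I) L →
                length L * 4 ^ T ≼ 4 ⊙ (β ^⊗ T ⊗ √2^ n)
  bound-short stop T [] F runs = 0≼ _
  bound-short stop T (I ∷ L) F (T≤tI ∷ _) with ≤-trans T≤tI (t≤1 stop I)
  ... | z≤n     = subst₂ _≼_ (sym (*-identityʳ _)) (trans (sym (⊙-as-⊗ 4 (√2^ n))) (cong (4 ⊙_) (sym (⊗-identityˡ (√2^ n)))))
                    (≼-grow {c = 3} {d = 0} (ht n V (I ∷ L) (size≤n V) F))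
  ... | s≤s z≤n = subst₂ _≼_ (*-comm 4 _) (cong (λ y → 4 ⊙ (y ⊗ √2^ n)) (sym (⊗-identityʳ β)))
                    (≼-⊙ 4 (≼-grow {c = 0} {d = 2} (ht n V (I ∷ L) (size≤n V) F)))

  bound-V : ∀ T L → Family V L → All (λ I → T ≤ t G ρ I) L → length L * 4 ^ T ≼ 4 ⊙ (β ^⊗ T ⊗ √2^ n)
  bound-V T L F runs with done V in stop
  ... | false = subst (length L * 4 ^ T ≼_) (sym (⊙-as-⊗ 4 (β ^⊗ T ⊗ √2^ n)))
                  (≼-grow {c = 3} {d = 0} (claim T n n V L (size≤n V) (inj₂ (done-false ∅ V stop)) F runs))
  ... | true  = bound-short stop T L F runs

-- If N 4^T ≤ 4 β^T √2^n and pn ≤ qT, then raising to the power Q = 2qK and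
-- cancelling (β/4)^(TQ − 2pnK) ≤ 1 gives N^Q 4^(2pnK) ≤ 4^Q 2^(nqK) β^(2pnK);
-- finally 4^Q ≤ 2^(2nq) because 2K ≤ n.

^-distribʳ-* : ∀ a b k → (a * b) ^ k ≡ a ^ k * b ^ k
^-distribʳ-* a b zero    = refl
^-distribʳ-* a b (suc k) = trans (cong (a * b *_) (^-distribʳ-* a b k)) (swap a b (a ^ k) (b ^ k))
  where
  swap : ∀ a b x y → a * b * (x * y) ≡ a * x * (b * y)
  swap = solve-∀

power-of-bound : ∀ z n j → (4 ⊙ (z ⊗ √2^ n)) ^⊗ (2 * j) ≡ (4 ^ (2 * j) * 2 ^ (n * j) , 0) ⊗ z ^⊗ (2 * j)
power-of-bound z n j = begin
  (4 ⊙ (z ⊗ √2^ n)) ^⊗ Q                 ≡⟨ cong (_^⊗ Q) (⊙-as-⊗ 4 (z ⊗ √2^ n)) ⟩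
  ((4 , 0) ⊗ (z ⊗ √2^ n)) ^⊗ Q           ≡⟨ ^⊗-distrib-⊗ (4 , 0) (z ⊗ √2^ n) Q ⟩
  (4 , 0) ^⊗ Q ⊗ (z ⊗ √2^ n) ^⊗ Q        ≡⟨ cong₂ _⊗_ (c0-^⊗ 4 Q) (^⊗-distrib-⊗ z (√2^ n) Q) ⟩
  (4 ^ Q , 0) ⊗ (z ^⊗ Q ⊗ √2^ n ^⊗ Q)    ≡⟨ cong (λ y → (4 ^ Q , 0) ⊗ (z ^⊗ Q ⊗ y)) (√2^-even-power n j) ⟩
  (4 ^ Q , 0) ⊗ (z ^⊗ Q ⊗ (2 ^ (n * j) , 0)) ≡⟨ cong ((4 ^ Q , 0) ⊗_) (⊗-comm (z ^⊗ Q) _) ⟩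
  (4 ^ Q , 0) ⊗ ((2 ^ (n * j) , 0) ⊗ z ^⊗ Q) ≡⟨ ⊗-assoc (4 ^ Q , 0) _ _ ⟨
  (4 ^ Q , 0) ⊗ (2 ^ (n * j) , 0) ⊗ z ^⊗ Q   ≡⟨ cong (_⊗ z ^⊗ Q) (c0⊗c0 (4 ^ Q) (2 ^ (n * j))) ⟩
  (4 ^ Q * 2 ^ (n * j) , 0) ⊗ z ^⊗ Q         ∎
  where
  open ≡-Reasoning
  Q = 2 * j

exponent-split : ∀ p q n K T → p * n ≤ q * T → T * (2 * (q * K)) ≡ 2 * p * n * K + 2 * K * (q * T ∸ p * n)
exponent-split p q n K T pn≤qT = begin
  T * (2 * (q * K))                    ≡⟨ l₁ T q K ⟩
  2 * K * (q * T)                      ≡⟨ cong (2 * K *_) (m+[n∸m]≡n pn≤qT) ⟨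
  2 * K * (p * n + (q * T ∸ p * n))    ≡⟨ l₂ K p n (q * T ∸ p * n) ⟩
  2 * p * n * K + 2 * K * (q * T ∸ p * n) ∎
  where
  open ≡-Reasoning
  l₁ : ∀ T q K → T * (2 * (q * K)) ≡ 2 * K * (q * T)
  l₁ = solve-∀
  l₂ : ∀ K p n D → 2 * K * (p * n + D) ≡ 2 * p * n * K + 2 * K * D
  l₂ = solve-∀

constant-≤ : ∀ n q K → 2 * K ≤ n → 4 ^ (2 * (q * K)) * 2 ^ (n * (q * K)) ≤ 2 ^ (n * q * K + 2 * n * q)
constant-≤ n q K 2K≤n = begin
  4 ^ (2 * j) * 2 ^ (n * j)          ≡⟨ cong (_* 2 ^ (n * j)) (^-*-assoc 2 2 (2 * j)) ⟩
  2 ^ (2 * (2 * j)) * 2 ^ (n * j)    ≡⟨ ^-distribˡ-+-* 2 (2 * (2 * j)) (n * j) ⟨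
  2 ^ (2 * (2 * j) + n * j)          ≤⟨ ^-monoʳ-≤ 2 exponent ⟩
  2 ^ (n * q * K + 2 * n * q)        ∎
  where
  open ≤-Reasoning
  j = q * K
  l₁ : ∀ q K n → 2 * (2 * (q * K)) + n * (q * K) ≡ n * q * K + (2 * K) * (2 * q)
  l₁ = solve-∀
  l₂ : ∀ q n → n * (2 * q) ≡ 2 * n * q
  l₂ = solve-∀
  exponent : 2 * (2 * j) + n * j ≤ n * q * K + 2 * n * q
  exponent = ≤-trans (≤-reflexive (l₁ q K n))
    (+-monoʳ-≤ (n * q * K) (≤-trans (*-monoˡ-≤ (2 * q) 2K≤n) (≤-reflexive (l₂ q n))))

powered-bound : ∀ n N T j P E → T * (2 * j) ≡ P + E → N * 4 ^ T ≼ 4 ⊙ (β ^⊗ T ⊗ √2^ n) →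
                N ^ (2 * j) * 4 ^ P * 4 ^ E ≼ (4 ^ (2 * j) * 2 ^ (n * j) , 0) ⊗ β ^⊗ P ⊗ β ^⊗ E
powered-bound n N T j P E split h = subst₂ _≼_ lhs rhs (≼-^ (2 * j) h)
  where
  open ≡-Reasoning
  c = 4 ^ (2 * j) * 2 ^ (n * j)
  lhs : (N * 4 ^ T) ^ (2 * j) ≡ N ^ (2 * j) * 4 ^ P * 4 ^ E
  lhs = begin
    (N * 4 ^ T) ^ (2 * j)              ≡⟨ ^-distribʳ-* N (4 ^ T) (2 * j) ⟩
    N ^ (2 * j) * (4 ^ T) ^ (2 * j)    ≡⟨ cong (N ^ (2 * j) *_) (^-*-assoc 4 T (2 * j)) ⟩
    N ^ (2 * j) * 4 ^ (T * (2 * j))    ≡⟨ cong (λ e → N ^ (2 * j) * 4 ^ e) split ⟩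
    N ^ (2 * j) * 4 ^ (P + E)          ≡⟨ cong (N ^ (2 * j) *_) (^-distribˡ-+-* 4 P E) ⟩
    N ^ (2 * j) * (4 ^ P * 4 ^ E)      ≡⟨ *-assoc (N ^ (2 * j)) (4 ^ P) (4 ^ E) ⟨
    N ^ (2 * j) * 4 ^ P * 4 ^ E        ∎
  rhs : (4 ⊙ (β ^⊗ T ⊗ √2^ n)) ^⊗ (2 * j) ≡ (c , 0) ⊗ β ^⊗ P ⊗ β ^⊗ E
  rhs = begin
    (4 ⊙ (β ^⊗ T ⊗ √2^ n)) ^⊗ (2 * j)  ≡⟨ power-of-bound (β ^⊗ T) n j ⟩
    (c , 0) ⊗ (β ^⊗ T) ^⊗ (2 * j)      ≡⟨ cong ((c , 0) ⊗_) (^⊗-* β T (2 * j)) ⟨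
    (c , 0) ⊗ β ^⊗ (T * (2 * j))       ≡⟨ cong (λ e → (c , 0) ⊗ β ^⊗ e) split ⟩
    (c , 0) ⊗ β ^⊗ (P + E)             ≡⟨ cong ((c , 0) ⊗_) (^⊗-+ β P E) ⟩
    (c , 0) ⊗ (β ^⊗ P ⊗ β ^⊗ E)        ≡⟨ ⊗-assoc (c , 0) (β ^⊗ P) (β ^⊗ E) ⟨
    (c , 0) ⊗ β ^⊗ P ⊗ β ^⊗ E          ∎

≼-constant-mono : ∀ {L c c'} x → c ≤ c' → L ≼ (c , 0) ⊗ x → L ≼ (c' , 0) ⊗ x
≼-constant-mono (a , b) c≤c' = ≼-monoʳ (+-monoˡ-≤ _ (*-monoˡ-≤ a c≤c')) (+-monoˡ-≤ _ (*-monoˡ-≤ b c≤c'))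

≼⇒Bound : ∀ n p q K N T → 2 * K ≤ n → p * n ≤ q * T →
          N * 4 ^ T ≼ 4 ⊙ (β ^⊗ T ⊗ √2^ n) → Bound N n p q K
≼⇒Bound n p q K N T 2K≤n pn≤qT h =
  subst (N ^ (2 * q * K) * 4 ^ P ≤√_) ι-eq (≼⇒≤√ (≼-constant-mono (β ^⊗ P) (constant-≤ n q K 2K≤n) cancelled))
  where
  P = 2 * p * n * K
  E = 2 * K * (q * T ∸ p * n)
  c' = 2 ^ (n * q * K + 2 * n * q)
  c = 4 ^ (2 * (q * K)) * 2 ^ (n * (q * K))
  -- cancel (β/4)^E ≤ 1
  cancelled : N ^ (2 * q * K) * 4 ^ P ≼ (c , 0) ⊗ β ^⊗ P
  cancelled = subst (λ e → N ^ e * 4 ^ P ≼ (c , 0) ⊗ β ^⊗ P) (sym (*-assoc 2 q K))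
    (≼-cancel-β E ((c , 0) ⊗ β ^⊗ P) (powered-bound n N T (q * K) P E (exponent-split p q n K T pn≤qT) h))
  ι-eq : ι ((c' , 0) ⊗ β ^⊗ P) ≡ fromℕ√ c' *√ (ι β ^√ P)
  ι-eq = trans (ι-⊗ (c' , 0) (β ^⊗ P)) (cong (fromℕ√ c' *√_) (ι-^ β P))

-- For n ≥ 2K: taking T = min t(I) over the listed sets, all of
-- them run ≥ T steps and pn ≤ qT, so the count bound gives Bound.
counting-bound : ∀ K n → 2 * K ≤ n → (G : Graph n) → TriangleFree G → (ρ : Permutation′ n) →
  (p q : ℕ) → 0 < q → (L : List (Subset n)) → Unique L →
  All (λ I → MaximalIndependent G I × p * n ≤ q * t G ρ I) L →
  Bound (length L) n p q K
counting-bound K n 2K≤n G triangle-free ρ p q 0<q L distinct hyps =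
  ≼⇒Bound n p q K (length L) Tmin 2K≤n pn≤qT
    (bound-V Tmin L (family-V L distinct (All.map proj₁ hyps)) (minimum-≤ (p * n) (t G ρ) L))
  where
  open Counting G ρ triangle-free
  Tmin = minimum (p * n) (t G ρ) L
  pn≤qT : p * n ≤ q * Tmin
  pn≤qT = minimum-attained (λ T → p * n ≤ q * T) (m≤n*m (p * n) q {{>-nonZero 0<q}}) (All.map proj₂ hyps)

-- the theorem, with ε = 1/(k + 1) and N = 2(k + 1)
lemma3p4 : (k : ℕ) → Σ ℕ λ N → (n : ℕ) → N ≤ n →
    (G : Graph n) → TriangleFree G → (ρ : Permutation′ n) →
    (p q : ℕ) → 0 < q → p ≤ q →
    (L : List (Subset n)) → Unique L →
    All (λ I → MaximalIndependent G I × p * n ≤ q * t G ρ I) L →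
    Bound (length L) n p q (suc k)
lemma3p4 k = 2 * suc k , λ n 2K≤n G triangle-free ρ p q 0<q _ → counting-bound (suc k) n 2K≤n G triangle-free ρ p q 0<q
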